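{- Let $V_0,V_1,\dots$ be indeterminates and let $\mathbf{b}=(b_i)_{i\ge0}$, $\boldsymbol{\lambda}=(\lambda_i)_{i\ge1}$ be given by $b_i=-V_i^{ -1}$ and $\lambda_i=V_i^{ -1}V_{i-1}^{ -1}$. Then for all integers $k\ge1$ and $n\ge1$, \[ \mu^{\le 3k}_{ -n}(\mathbf{b},\boldsymbol{\lambda})=(-1)^nV_0\sum_{\pi\in\widetilde{\mathrm{PV}}^{3,3k}_{n-1}}\mathrm{wt}(\pi). \]
   Context: A Motzkin path is a finite sequence of points in $\mathbb{Z}\times\mathbb{Z}_{\ge0}$ whose steps are each $(1,1)$, $(1,0)$ or $(1,-1)$; its weight is the product of $b_i$ over horizontal steps starting at height $i$ and $\lambda_i$ over down steps starting at height $i$. $\mu^{\le K}_N(\mathbf{b},\boldsymbol{\lambda})$ ($N\ge0$) is the sum of weights of Motzkin paths from $(0,0)$ to $(N,0)$ staying weakly below $y=K$. If $(f_N)_{N\ge0}$ satisfies $f_N=c_1f_{N-1}+\cdots+c_df_{N-d}$ for all $N\ge d$ with $c_d\ne0$, it is extended uniquely to all $N\in\mathbb{Z}$ so the recurrence holds for all $N$; $\mu^{\le K}_{ -N}$ denotes this extension (it exists here). $\mathrm{wt}((a_1,\dots,a_N))=V_{a_1}\cdots V_{a_N}$ (empty sequence: $1$). A modified $3$-peak-valley sequence is a sequence $(a_1,\dots,a_N)$ of nonnegative integers such that, with $a_0=a_{N+1}=0$, each $a_i\equiv1\pmod3$ satisfies $a_{i-1}>a_i<a_{i+1}$ and each $a_i\equiv2\pmod3$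 satisfies $a_{i-1}<a_i>a_{i+1}$ ($1\le i\le N$); $\widetilde{\mathrm{PV}}^{3,K}_N$ is the set of those of length $N$ with entries in $\{0,\dots,K\}$ ($\widetilde{\mathrm{PV}}^{3,K}_0$ is the set containing the empty sequence). -}

module Defs where

open import Data.Bool using (Bool; true; false; _∧_; if_then_else_)
open import Data.Nat as ℕ using (ℕ; zero; suc; _≡ᵇ_; _<ᵇ_; _%_)
open import Data.Integer as ℤ using (ℤ; +_; -[1+_])
open import Data.Fin using (Fin; toℕ)
open import Data.Vec as Vec using (Vec)
open import Data.Vec.Properties using (≡-dec)
open import Data.List as List using (List; []; _∷_; _++_; [_]; concatMap; map; foldr; filterᵇ; allFin)
open import Data.Product using (_×_; _,_)
open import Relation.Nullary using (yes; no)
open import Relation.Binary.PropositionalEquality using (_≡_)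

-- The Laurent polynomial ring  ℤ[V₀^{±1}, …, V_{m-1}^{±1}]
-- An element is a finite formal sum of terms  a · V^e  (a ∈ ℤ, e ∈ ℤ^m);
-- two elements are equal iff all their coefficients agree.

Laurent : ℕ → Set
Laurent m = List (ℤ × Vec ℤ m)

coeff : ∀ {m} → Laurent m → Vec ℤ m → ℤ
coeff [] e = + 0
coeff ((a , f) ∷ p) e with ≡-dec ℤ._≟_ f e
... | yes _ = a ℤ.+ coeff p e
... | no  _ = coeff p e

infix 4 _≈_
_≈_ : ∀ {m} → Laurent m → Laurent m → Set
p ≈ q = ∀ e → coeff p e ≡ coeff q e

infixl 6 _⊕_
infixl 7 _⊗_

_⊕_ : ∀ {m} → Laurent m → Laurent m → Laurent m
p ⊕ q = p ++ q

_⊗_ : ∀ {m} → Laurent m → Laurent m → Laurent m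
p ⊗ q = concatMap (λ { (a , f) → map (λ { (b , g) → (a ℤ.* b , Vec.zipWith ℤ._+_ f g) }) q }) p

0L : ∀ {m} → Laurent m
0L = []

constL : ∀ {m} → ℤ → Laurent m
constL {m} a = [ (a , Vec.replicate m (+ 0)) ]

1L : ∀ {m} → Laurent m
1L = constL (+ 1)

sumL : ∀ {m} → List (Laurent m) → Laurent m
sumL = foldr _⊕_ 0L

prodL : ∀ {m} → List (Laurent m) → Laurent m
prodL = foldr _⊗_ 1L

-- V_i ^ z  (for i < m; indices i ≥ m never occur below)
Vpow : ∀ {m} → ℕ → ℤ → Laurent m
Vpow {m} i z = [ (+ 1 , Vec.tabulate (λ j → if toℕ j ≡ᵇ i then z else + 0)) ]

V : ∀ {m} → ℕ → Laurent m
V i = Vpow i (+ 1)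

Vinv : ∀ {m} → ℕ → Laurent m
Vinv i = Vpow i (ℤ.- (+ 1))

bw : ∀ {m} → ℕ → Laurent m
bw i = constL (ℤ.- (+ 1)) ⊗ Vinv i

λw : ∀ {m} → ℕ → Laurent m
λw zero    = 0L     -- never used (no down step starts at height 0)
λw (suc i) = Vinv (suc i) ⊗ Vinv i

-- Motzkin paths, encoded by their step sequences

data Step : Set where
  U H D : Step

allSteps : ℕ → List (List Step)
allSteps zero    = [ [] ]
allSteps (suc n) = concatMap (λ s → (U ∷ s) ∷ (H ∷ s) ∷ (D ∷ s) ∷ []) (allSteps n)

validFrom : ℕ → ℕ → List Step → Bool
validFrom K h []             = h ≡ᵇ 0
validFrom K h (U ∷ s)        = (h <ᵇ K) ∧ validFrom K (suc h) s
validFrom K h (H ∷ s)        = validFrom K h s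
validFrom K zero (D ∷ s)     = false
validFrom K (suc h) (D ∷ s)  = validFrom K h s

weightFrom : ∀ {m} → ℕ → List Step → Laurent m
weightFrom h []       = 1L
weightFrom h (U ∷ s)  = weightFrom (suc h) s
weightFrom h (H ∷ s)  = bw h ⊗ weightFrom h s
weightFrom h (D ∷ s)  = λw h ⊗ weightFrom (ℕ.pred h) s

μ≤ : ∀ {m} → ℕ → ℕ → Laurent m
μ≤ K N = sumL (map (weightFrom 0) (filterᵇ (validFrom K 0) (allSteps N)))

-- Extension of a sequence to ℤ by a linear recurrence
-- f_N = c_1 f_{N-1} + ⋯ + c_d f_{N-d}; here c (i : Fin d) is c_{i+1}.

SatisfiesRecOnℤ : ∀ {m} (d : ℕ) → (Fin d → Laurent m) → (ℤ → Laurent m) → Set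
SatisfiesRecOnℤ d c g =
  ∀ (N : ℤ) → g N ≈ sumL (map (λ i → c i ⊗ g (N ℤ.- + suc (toℕ i))) (allFin d))

allSeqs : ℕ → ℕ → List (List ℕ)
allSeqs K zero    = [ [] ]
allSeqs K (suc n) = concatMap (λ s → map (λ a → a ∷ s) (List.upTo (suc K))) (allSeqs K n)

pvCond : ℕ → ℕ → ℕ → Bool
pvCond x y z =
  (if (y % 3) ≡ᵇ 1 then (y <ᵇ x) ∧ (y <ᵇ z) else true) ∧
  (if (y % 3) ≡ᵇ 2 then (x <ᵇ y) ∧ (z <ᵇ y) else true)

windows : List ℕ → Bool
windows (x ∷ y ∷ z ∷ r) = pvCond x y z ∧ windows (y ∷ z ∷ r)
windows _               = true

isModPV3 : List ℕ → Bool
isModPV3 a = windows (0 ∷ a ++ [ 0 ])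

modPV3 : ℕ → ℕ → List (List ℕ)
modPV3 K N = filterᵇ isModPV3 (allSeqs K N)

wt : ∀ {m} → List ℕ → Laurent m
wt a = prodL (map V a)

rhs : ∀ {m} → ℕ → ℕ → Laurent m
rhs K n = constL ((ℤ.- (+ 1)) ℤ.^ n) ⊗ V 0 ⊗ sumL (map wt (modPV3 K (ℕ.pred n)))

{-# OPTIONS --safe #-}
-- Weighted Motzkin paths of height at most K = 3k are counted by the tridiagonal transfer
-- matrix T on heights 0 … K (T_{h,h+1} = 1, T_{h,h} = b_h, T_{h,h-1} = λ_h): μ_N = (Tᴺ e₀)₀.
-- For these weights T has an explicit inverse. Let A_{x,l} = 1 when l may follow x in a
-- modified 3-peak-valley sequence and B_{n+1}(x) = −V_x Σ_l A_{x,l} B_n(l), B₀ = e₀; then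
-- H_n(h) = sign(h) V₁⁻¹ ⋯ V_h⁻¹ B_n(h) satisfies T H_{n+1} = H_n. Entry by entry this identity
-- depends only on residues mod 3 and on the position of l relative to h, so it is checked
-- case by case. Hence N ↦ Tᴺ e₀ extends to N < 0 through H, and (H_n)₀ = B_n(0) is the
-- signed peak-valley sum. Any two-sided orbit of T satisfies the recurrence given by the
-- characteristic polynomial of T. Its constant term is ±V₀⁻¹ ⋯ V_K⁻¹ ≠ 0: the leading
-- coefficients of the principal minors vanish exactly at sizes ≡ 2 (mod 3), and K + 1 ≡ 1.
module Submission where

open import Algebra.Bundles using (AbelianGroup; CommutativeRing; Group)
open import Algebra.Structures using (IsCommutativeRing)
import Algebra.Properties.Group as GroupProperties
import Algebra.Solver.Ring as RingSolver
open import Algebra.Solver.Ring.AlmostCommutativeRing using (fromCommutativeRing; _-Raw-AlmostCommutative⟶_)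
open import Data.Bool using (Bool; true; false; if_then_else_; T)
open import Data.Fin as Fin using (Fin; toℕ)
open import Data.List as List
  using (List; []; _∷_; [_]; _++_; map; foldr; concatMap; filterᵇ; applyUpTo; upTo; allFin)
open import Data.List.Properties using (map-tabulate; ++-assoc; length-map)
open import Data.Nat using (ℕ; zero; suc; _<_; _≤_; _<ᵇ_; _≡ᵇ_; s≤s; z≤n)
open import Data.Nat.Properties using (≡ᵇ⇒≡)
open import Data.Maybe using (just; nothing)
open import Data.Product using (Σ; _×_; _,_; proj₁; proj₂)
open import Data.Vec as Vec using (Vec; []; _∷_)
open import Data.Vec.Properties using (≡-dec; zipWith-comm; zipWith-assoc; zipWith-identityˡ)
open import Function using (_∘_; id)
open import Level using (0ℓ)
open import Relation.Binary.Definitions using (WeaklyDecidable)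
open import Relation.Binary.PropositionalEquality as ≡ using (_≡_; _≢_)
open import Relation.Nullary using (¬_; yes; no; contradiction)

<ᵇ-true : ∀ {m n} → m < n → (m <ᵇ n) ≡ true
<ᵇ-true {zero}  {suc n} _         = ≡.refl
<ᵇ-true {suc m} {suc n} (s≤s m<n) = <ᵇ-true m<n

<ᵇ-false : ∀ {m n} → n ≤ m → (m <ᵇ n) ≡ false
<ᵇ-false {m}     {zero}  _         = ≡.refl
<ᵇ-false {suc m} {suc n} (s≤s n≤m) = <ᵇ-false n≤m

≡ᵇ-false : ∀ {m n} → m ≢ n → (m ≡ᵇ n) ≡ false
≡ᵇ-false {m} {n} m≢n with m ≡ᵇ n in eq
... | true  = contradiction (≡ᵇ⇒≡ m n (≡.subst T (≡.sym eq) _)) m≢n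
... | false = ≡.refl

≡ᵇ-refl : ∀ n → (n ≡ᵇ n) ≡ true
≡ᵇ-refl zero    = ≡.refl
≡ᵇ-refl (suc n) = ≡ᵇ-refl n

module ListSum {c ℓ} (R : CommutativeRing c ℓ) where
  open CommutativeRing R
  open import Algebra.Properties.CommutativeSemigroup +-commutativeSemigroup using (interchange)
  open import Algebra.Properties.Ring ring using (-‿+-comm)

  ∑ : {A : Set} → List A → (A → Carrier) → Carrier
  ∑ xs F = foldr _+_ 0# (map F xs)

  ∑-cong : {A : Set} (xs : List A) {F G : A → Carrier} → (∀ x → F x ≈ G x) → ∑ xs F ≈ ∑ xs G
  ∑-cong []       F≈G = refl
  ∑-cong (x ∷ xs) F≈G = +-cong (F≈G x) (∑-cong xs F≈G)

  ∑-zero : {A : Set} (xs : List A) {F : A → Carrier} → (∀ x → F x ≈ 0#) → ∑ xs F ≈ 0#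
  ∑-zero []       F≈0 = refl
  ∑-zero (x ∷ xs) F≈0 = trans (+-cong (F≈0 x) (∑-zero xs F≈0)) (+-identityˡ 0#)

  ∑-map : {A B : Set} (g : A → B) (xs : List A) (F : B → Carrier) → ∑ (map g xs) F ≡ ∑ xs (F ∘ g)
  ∑-map g []       F = ≡.refl
  ∑-map g (x ∷ xs) F = ≡.cong (F (g x) +_) (∑-map g xs F)

  ∑-++ : {A : Set} (xs ys : List A) (F : A → Carrier) → ∑ (xs ++ ys) F ≈ ∑ xs F + ∑ ys F
  ∑-++ []       ys F = sym (+-identityˡ _)
  ∑-++ (x ∷ xs) ys F = trans (+-congˡ (∑-++ xs ys F)) (sym (+-assoc (F x) _ _))

  ∑-concatMap : {A B : Set} (g : A → List B) (xs : List A) (F : B → Carrier) →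
                ∑ (concatMap g xs) F ≈ ∑ xs (λ x → ∑ (g x) F)
  ∑-concatMap g []       F = refl
  ∑-concatMap g (x ∷ xs) F = trans (∑-++ (g x) (concatMap g xs) F) (+-congˡ (∑-concatMap g xs F))

  ∑-distrib-+ : {A : Set} (xs : List A) (F G : A → Carrier) →
                ∑ xs (λ x → F x + G x) ≈ ∑ xs F + ∑ xs G
  ∑-distrib-+ []       F G = sym (+-identityˡ 0#)
  ∑-distrib-+ (x ∷ xs) F G = trans (+-congˡ (∑-distrib-+ xs F G)) (interchange (F x) (G x) _ _)

  ∑-comm : {A B : Set} (xs : List A) (ys : List B) (F : A → B → Carrier) →
           ∑ xs (λ x → ∑ ys (F x)) ≈ ∑ ys (λ y → ∑ xs (λ x → F x y))
  ∑-comm []       ys F = sym (∑-zero ys (λ _ → refl))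
  ∑-comm (x ∷ xs) ys F = trans (+-congˡ (∑-comm xs ys F)) (sym (∑-distrib-+ ys (F x) _))

  *-distribˡ-∑ : {A : Set} (a : Carrier) (xs : List A) (F : A → Carrier) →
                 a * ∑ xs F ≈ ∑ xs (λ x → a * F x)
  *-distribˡ-∑ a []       F = zeroʳ a
  *-distribˡ-∑ a (x ∷ xs) F = trans (distribˡ a (F x) _) (+-congˡ (*-distribˡ-∑ a xs F))

  -‿distrib-∑ : {A : Set} (xs : List A) (F : A → Carrier) → - ∑ xs F ≈ ∑ xs (λ x → - F x)
  -‿distrib-∑ []       F = -0#≈0#
    where open import Algebra.Properties.Ring ring using (-0#≈0#)
  -‿distrib-∑ (x ∷ xs) F = trans (sym (-‿+-comm (F x) _)) (+-congˡ (-‿distrib-∑ xs F))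

  ∑-filterᵇ : {A : Set} (p : A → Bool) (xs : List A) (F : A → Carrier) →
              ∑ (filterᵇ p xs) F ≈ ∑ xs (λ x → if p x then F x else 0#)
  ∑-filterᵇ p []       F = refl
  ∑-filterᵇ p (x ∷ xs) F with p x
  ... | true  = +-congˡ (∑-filterᵇ p xs F)
  ... | false = trans (∑-filterᵇ p xs F) (sym (+-identityˡ _))

  ∑-if : ∀ b {A : Set} (xs : List A) (F : A → Carrier) →
         ∑ xs (λ x → if b then F x else 0#) ≈ (if b then ∑ xs F else 0#)
  ∑-if true  xs F = refl
  ∑-if false xs F = ∑-zero xs (λ _ → refl)

  ∑< : ℕ → (ℕ → Carrier) → Carrier
  ∑< zero    F = 0#
  ∑< (suc n) F = F 0 + ∑< n (F ∘ suc)

  ∑<-cong : ∀ n {F G : ℕ → Carrier} → (∀ i → i < n → F i ≈ G i) → ∑< n F ≈ ∑< n G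
  ∑<-cong zero    F≈G = refl
  ∑<-cong (suc n) F≈G = +-cong (F≈G 0 (s≤s z≤n)) (∑<-cong n (λ i i<n → F≈G (suc i) (s≤s i<n)))

  ∑<-zero : ∀ n {F : ℕ → Carrier} → (∀ i → F i ≈ 0#) → ∑< n F ≈ 0#
  ∑<-zero zero    F≈0 = refl
  ∑<-zero (suc n) F≈0 = trans (+-cong (F≈0 0) (∑<-zero n (F≈0 ∘ suc))) (+-identityˡ 0#)

  ∑<-indicator : ∀ n j (F : ℕ → Carrier) → j < n → ∑< n (λ i → if i ≡ᵇ j then F i else 0#) ≈ F j
  ∑<-indicator (suc n) zero    F _         = trans (+-congˡ (∑<-zero n (λ _ → refl))) (+-identityʳ (F 0))
  ∑<-indicator (suc n) (suc j) F (s≤s j<n) = trans (+-identityˡ _) (∑<-indicator n j (F ∘ suc) j<n)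

  ∑<-distrib-+ : ∀ n (F G : ℕ → Carrier) → ∑< n (λ i → F i + G i) ≈ ∑< n F + ∑< n G
  ∑<-distrib-+ zero    F G = sym (+-identityˡ 0#)
  ∑<-distrib-+ (suc n) F G = trans (+-congˡ (∑<-distrib-+ n (F ∘ suc) (G ∘ suc))) (interchange (F 0) (G 0) _ _)

  *-distribˡ-∑< : ∀ n (a : Carrier) (F : ℕ → Carrier) → a * ∑< n F ≈ ∑< n (λ i → a * F i)
  *-distribˡ-∑< zero    a F = zeroʳ a
  *-distribˡ-∑< (suc n) a F = trans (distribˡ a (F 0) _) (+-congˡ (*-distribˡ-∑< n a (F ∘ suc)))

  ∑-applyUpTo : ∀ (f : ℕ → ℕ) n (F : ℕ → Carrier) → ∑ (applyUpTo f n) F ≡ ∑< n (F ∘ f)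
  ∑-applyUpTo f zero    F = ≡.refl
  ∑-applyUpTo f (suc n) F = ≡.cong (F (f 0) +_) (∑-applyUpTo (f ∘ suc) n F)

  ∑-upTo : ∀ n (F : ℕ → Carrier) → ∑ (upTo n) F ≡ ∑< n F
  ∑-upTo = ∑-applyUpTo id

  ∑-allFin : ∀ n (F : ℕ → Carrier) → ∑ (allFin n) (F ∘ toℕ) ≡ ∑< n F
  ∑-allFin n F = ≡.trans (≡.cong (foldr _+_ 0#) (map-tabulate {n = n} id (F ∘ toℕ))) (sum-tabulate n F)
    where
    sum-tabulate : ∀ n (F : ℕ → Carrier) → foldr _+_ 0# (List.tabulate {n = n} (F ∘ toℕ)) ≡ ∑< n F
    sum-tabulate zero    F = ≡.refl
    sum-tabulate (suc n) F = ≡.cong (F 0 +_) (sum-tabulate n (F ∘ suc))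

module CoefficientLists {c ℓ} (R : CommutativeRing c ℓ) where
  open CommutativeRing R
  open import Algebra.Properties.CommutativeSemigroup +-commutativeSemigroup using (interchange)
  open ListSum R using (∑<; ∑<-zero)
  open import Algebra.Properties.Ring ring using (-0#≈0#; -‿distribˡ-*; -‿+-comm)

  coeffAt : List Carrier → ℕ → Carrier
  coeffAt []      i       = 0#
  coeffAt (a ∷ p) zero    = a
  coeffAt (a ∷ p) (suc i) = coeffAt p i

  infixl 6 _⊞_
  _⊞_ : List Carrier → List Carrier → List Carrier
  []      ⊞ q       = q
  (a ∷ p) ⊞ []      = a ∷ p
  (a ∷ p) ⊞ (b ∷ q) = (a + b) ∷ (p ⊞ q)

  scale : Carrier → List Carrier → List Carrier
  scale c = map (c *_)

  weightedSum : List Carrier → (ℕ → Carrier) → Carrier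
  weightedSum []      f = 0#
  weightedSum (a ∷ p) f = a * f 0 + weightedSum p (f ∘ suc)

  weightedSum-cong : ∀ p {f g : ℕ → Carrier} → (∀ i → f i ≈ g i) → weightedSum p f ≈ weightedSum p g
  weightedSum-cong []      f≈g = refl
  weightedSum-cong (a ∷ p) f≈g = +-cong (*-congˡ (f≈g 0)) (weightedSum-cong p (f≈g ∘ suc))

  weightedSum-⊞ : ∀ p q f → weightedSum (p ⊞ q) f ≈ weightedSum p f + weightedSum q f
  weightedSum-⊞ []      q       f = sym (+-identityˡ _)
  weightedSum-⊞ (a ∷ p) []      f = sym (+-identityʳ _)
  weightedSum-⊞ (a ∷ p) (b ∷ q) f =
    trans (+-cong (distribʳ (f 0) a b) (weightedSum-⊞ p q (f ∘ suc))) (interchange _ _ _ _)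

  weightedSum-scale : ∀ c p f → weightedSum (scale c p) f ≈ c * weightedSum p f
  weightedSum-scale c []      f = sym (zeroʳ c)
  weightedSum-scale c (a ∷ p) f =
    trans (+-cong (*-assoc c a (f 0)) (weightedSum-scale c p (f ∘ suc))) (sym (distribˡ c _ _))

  weightedSum-shift : ∀ p f → weightedSum (0# ∷ p) f ≈ weightedSum p (f ∘ suc)
  weightedSum-shift p f = trans (+-congʳ (zeroˡ (f 0))) (+-identityˡ _)

  weightedSum-head : ∀ p f → weightedSum p f ≈ coeffAt p 0 * f 0 + weightedSum (List.drop 1 p) (f ∘ suc)
  weightedSum-head []      f = sym (trans (+-congʳ (zeroˡ (f 0))) (+-identityˡ 0#))
  weightedSum-head (a ∷ p) f = refl

  weightedSum≈∑< : ∀ p n f → List.length p ≤ n → weightedSum p f ≈ ∑< n (λ i → coeffAt p i * f i)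
  weightedSum≈∑< []      n       f _         = sym (∑<-zero n (λ i → zeroˡ (f i)))
  weightedSum≈∑< (a ∷ p) (suc n) f (s≤s p≤n) = +-congˡ (weightedSum≈∑< p n (f ∘ suc) p≤n)

  coeffAt-⊞ : ∀ p q i → coeffAt (p ⊞ q) i ≈ coeffAt p i + coeffAt q i
  coeffAt-⊞ []      q       i       = sym (+-identityˡ _)
  coeffAt-⊞ (a ∷ p) []      zero    = sym (+-identityʳ _)
  coeffAt-⊞ (a ∷ p) []      (suc i) = sym (+-identityʳ _)
  coeffAt-⊞ (a ∷ p) (b ∷ q) zero    = refl
  coeffAt-⊞ (a ∷ p) (b ∷ q) (suc i) = coeffAt-⊞ p q i

  coeffAt-scale : ∀ c p i → coeffAt (scale c p) i ≈ c * coeffAt p i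
  coeffAt-scale c []      i       = sym (zeroʳ c)
  coeffAt-scale c (a ∷ p) zero    = refl
  coeffAt-scale c (a ∷ p) (suc i) = coeffAt-scale c p i

  coeffAt-map- : ∀ p i → coeffAt (map -_ p) i ≈ - coeffAt p i
  coeffAt-map- []      i       = sym -0#≈0#
  coeffAt-map- (a ∷ p) zero    = refl
  coeffAt-map- (a ∷ p) (suc i) = coeffAt-map- p i

  coeffAt-beyond : ∀ p i → List.length p ≤ i → coeffAt p i ≡ 0#
  coeffAt-beyond []      i       _         = ≡.refl
  coeffAt-beyond (a ∷ p) (suc i) (s≤s p≤i) = coeffAt-beyond p i p≤i

  length-⊞ : ∀ p q {n} → List.length p ≤ n → List.length q ≤ n → List.length (p ⊞ q) ≤ n
  length-⊞ []      q       _         q≤n       = q≤n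
  length-⊞ (a ∷ p) []      p≤n       _         = p≤n
  length-⊞ (a ∷ p) (b ∷ q) (s≤s p≤n) (s≤s q≤n) = s≤s (length-⊞ p q p≤n q≤n)

  length-shift-scale : ∀ c p {n} → List.length p ≤ n → List.length (0# ∷ scale c p) ≤ suc n
  length-shift-scale c p p≤n = s≤s (≡.subst (_≤ _) (≡.sym (length-map (c *_) p)) p≤n)

  weightedSum-map- : ∀ p f → weightedSum (map -_ p) f ≈ - weightedSum p f
  weightedSum-map- []      f = sym -0#≈0#
  weightedSum-map- (a ∷ p) f =
    trans (+-cong (sym (-‿distribˡ-* a (f 0))) (weightedSum-map- p (f ∘ suc))) (-‿+-comm _ _)

  coeffAt-drop1 : ∀ p i → coeffAt (List.drop 1 p) i ≡ coeffAt p (suc i)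
  coeffAt-drop1 []      i = ≡.refl
  coeffAt-drop1 (a ∷ p) i = ≡.refl

open import Data.Integer as ℤ using (ℤ; +_)
import Data.Integer.Properties as ℤP
open import Defs

module LaurentRing (m : ℕ) where

  Exp : Set
  Exp = Vec ℤ m

  infix 4 _≋_
  -- _≈_ unfolds to a function type, from which Agda cannot infer its two sides;
  -- wrapped in a record it serves as the setoid equality of the ring.
  record _≋_ (p q : Laurent m) : Set where
    constructor mk≋
    field ≋⇒≈ : p ≈ q
  open _≋_ public

  open ≡ using (refl; sym; trans; cong; cong₂; module ≡-Reasoning)

  private
    module ℤΣ = ListSum ℤP.+-*-commutativeRing
    open ℤΣ using (∑)
    ℤ-group = AbelianGroup.group ℤP.+-0-abelianGroup
    open Group ℤ-group using (_\\_)
    module ℤGroup = GroupProperties ℤ-group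

  infixl 6 _+ᵉ_
  _+ᵉ_ : ∀ {n} → Vec ℤ n → Vec ℤ n → Vec ℤ n
  _+ᵉ_ = Vec.zipWith ℤ._+_

  _\\ᵉ_ : ∀ {n} → Vec ℤ n → Vec ℤ n → Vec ℤ n
  _\\ᵉ_ = Vec.zipWith _\\_

  +ᵉ-\\ᵉ : ∀ {n} (f e : Vec ℤ n) → f +ᵉ (f \\ᵉ e) ≡ e
  +ᵉ-\\ᵉ []       []       = refl
  +ᵉ-\\ᵉ (x ∷ f) (z ∷ e) = cong₂ _∷_ (ℤGroup.\\-leftDividesˡ x z) (+ᵉ-\\ᵉ f e)

  \\ᵉ-+ᵉ : ∀ {n} (f g : Vec ℤ n) → f \\ᵉ (f +ᵉ g) ≡ g
  \\ᵉ-+ᵉ []       []       = refl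
  \\ᵉ-+ᵉ (x ∷ f) (y ∷ g) = cong₂ _∷_ (ℤGroup.\\-leftDividesʳ x y) (\\ᵉ-+ᵉ f g)

  termCoeff : ℤ × Exp → Exp → ℤ
  termCoeff (a , f) e with ≡-dec ℤ._≟_ f e
  ... | yes _ = a
  ... | no  _ = + 0

  coeff-∑ : ∀ (p : Laurent m) e → coeff p e ≡ ∑ p (λ t → termCoeff t e)
  coeff-∑ []            e = refl
  coeff-∑ ((a , f) ∷ p) e with ≡-dec ℤ._≟_ f e
  ... | yes _ = cong₂ ℤ._+_ (refl {x = a}) (coeff-∑ p e)
  ... | no  _ = trans (coeff-∑ p e) (sym (ℤP.+-identityˡ _))

  termCoeff-self : ∀ a f → termCoeff (a , f) f ≡ a
  termCoeff-self a f with ≡-dec ℤ._≟_ f f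
  ... | yes _  = refl
  ... | no f≢f = contradiction refl f≢f

  termCoeff-* : ∀ a b f e → termCoeff (a ℤ.* b , f) e ≡ a ℤ.* termCoeff (b , f) e
  termCoeff-* a b f e with ≡-dec ℤ._≟_ f e
  ... | yes _ = refl
  ... | no  _ = sym (ℤP.*-zeroʳ a)

  termCoeff-neg : ∀ a f e → termCoeff (ℤ.- a , f) e ≡ ℤ.- termCoeff (a , f) e
  termCoeff-neg a f e with ≡-dec ℤ._≟_ f e
  ... | yes _ = refl
  ... | no  _ = refl

  termCoeff-+ : ∀ a b f e → termCoeff (a ℤ.+ b , f) e ≡ termCoeff (a , f) e ℤ.+ termCoeff (b , f) e
  termCoeff-+ a b f e with ≡-dec ℤ._≟_ f e
  ... | yes _ = refl
  ... | no  _ = refl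

  termCoeff-shift : ∀ a f g e → termCoeff (a , f +ᵉ g) e ≡ termCoeff (a , g) (f \\ᵉ e)
  termCoeff-shift a f g e with ≡-dec ℤ._≟_ (f +ᵉ g) e | ≡-dec ℤ._≟_ g (f \\ᵉ e)
  ... | yes _     | yes _     = refl
  ... | no  _     | no  _     = refl
  ... | yes f+g≡e | no  g≢f\e = contradiction (trans (sym (\\ᵉ-+ᵉ f g)) (cong (f \\ᵉ_) f+g≡e)) g≢f\e
  ... | no  f+g≢e | yes g≡f\e = contradiction (trans (cong (f +ᵉ_) g≡f\e) (+ᵉ-\\ᵉ f e)) f+g≢e

  coeff-⊕ : ∀ (p q : Laurent m) e → coeff (p ⊕ q) e ≡ coeff p e ℤ.+ coeff q e
  coeff-⊕ p q e = begin
    coeff (p ++ q) e                                      ≡⟨ coeff-∑ (p ++ q) e ⟩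
    ∑ (p ++ q) (λ t → termCoeff t e)                      ≡⟨ ℤΣ.∑-++ p q _ ⟩
    ∑ p (λ t → termCoeff t e) ℤ.+ ∑ q (λ t → termCoeff t e) ≡⟨ cong₂ ℤ._+_ (coeff-∑ p e) (coeff-∑ q e) ⟨
    coeff p e ℤ.+ coeff q e                               ∎
    where open ≡-Reasoning

  infixl 7 _·ᵗ_
  _·ᵗ_ : ℤ × Exp → ℤ × Exp → ℤ × Exp
  (a , f) ·ᵗ (b , g) = (a ℤ.* b , f +ᵉ g)

  coeff-⊗ : ∀ (p q : Laurent m) e → coeff (p ⊗ q) e ≡ ∑ p (λ s → ∑ q (λ t → termCoeff (s ·ᵗ t) e))
  coeff-⊗ p q e = begin
    coeff (p ⊗ q) e                                          ≡⟨ coeff-∑ (p ⊗ q) e ⟩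
    ∑ (concatMap (λ s → map (s ·ᵗ_) q) p) (λ t → termCoeff t e) ≡⟨ ℤΣ.∑-concatMap (λ s → map (s ·ᵗ_) q) p _ ⟩
    ∑ p (λ s → ∑ (map (s ·ᵗ_) q) (λ t → termCoeff t e))     ≡⟨ ℤΣ.∑-cong p (λ s → ℤΣ.∑-map (s ·ᵗ_) q _) ⟩
    ∑ p (λ s → ∑ q (λ t → termCoeff (s ·ᵗ t) e))            ∎
    where open ≡-Reasoning

  -- Convolution: only the term of q at exponent e − f meets a term (a , f) of p.
  coeff-⊗-convolution : ∀ (p q : Laurent m) e →
                        coeff (p ⊗ q) e ≡ ∑ p (λ s → proj₁ s ℤ.* coeff q (proj₂ s \\ᵉ e))
  coeff-⊗-convolution p q e = trans (coeff-⊗ p q e) (ℤΣ.∑-cong p single)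
    where
    single : ∀ s → ∑ q (λ t → termCoeff (s ·ᵗ t) e) ≡ proj₁ s ℤ.* coeff q (proj₂ s \\ᵉ e)
    single (a , f) = begin
      ∑ q (λ t → termCoeff (a ℤ.* proj₁ t , f +ᵉ proj₂ t) e)
        ≡⟨ ℤΣ.∑-cong q (λ t → trans (termCoeff-shift _ f _ e) (termCoeff-* a _ _ _)) ⟩
      ∑ q (λ t → a ℤ.* termCoeff t (f \\ᵉ e))
        ≡⟨ ℤΣ.*-distribˡ-∑ a q _ ⟨
      a ℤ.* ∑ q (λ t → termCoeff t (f \\ᵉ e))
        ≡⟨ cong (a ℤ.*_) (coeff-∑ q (f \\ᵉ e)) ⟨
      a ℤ.* coeff q (f \\ᵉ e) ∎
      where open ≡-Reasoning

  -ᴸ_ : Laurent m → Laurent m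
  -ᴸ p = map (λ (a , f) → (ℤ.- a , f)) p

  coeff-neg : ∀ (p : Laurent m) e → coeff (-ᴸ p) e ≡ ℤ.- coeff p e
  coeff-neg p e = begin
    coeff (-ᴸ p) e
      ≡⟨ coeff-∑ (-ᴸ p) e ⟩
    ∑ (-ᴸ p) (λ t → termCoeff t e)
      ≡⟨ ℤΣ.∑-map _ p _ ⟩
    ∑ p (λ t → termCoeff (ℤ.- proj₁ t , proj₂ t) e)
      ≡⟨ ℤΣ.∑-cong p (λ t → termCoeff-neg (proj₁ t) (proj₂ t) e) ⟩
    ∑ p (λ t → ℤ.- termCoeff t e)
      ≡⟨ ℤΣ.-‿distrib-∑ p _ ⟨
    ℤ.- ∑ p (λ t → termCoeff t e)
      ≡⟨ cong ℤ.-_ (coeff-∑ p e) ⟨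
    ℤ.- coeff p e ∎
    where open ≡-Reasoning

  ≋-refl : ∀ {p} → p ≋ p
  ≋-refl = mk≋ (λ _ → refl)

  ≋-sym : ∀ {p q} → p ≋ q → q ≋ p
  ≋-sym (mk≋ p≈q) = mk≋ (λ e → sym (p≈q e))

  ≋-trans : ∀ {p q r} → p ≋ q → q ≋ r → p ≋ r
  ≋-trans (mk≋ p≈q) (mk≋ q≈r) = mk≋ (λ e → trans (p≈q e) (q≈r e))

  ≋-reflexive : ∀ {p q} → p ≡ q → p ≋ q
  ≋-reflexive refl = ≋-refl

  ⊕-cong : ∀ {p p′ q q′} → p ≋ p′ → q ≋ q′ → p ⊕ q ≋ p′ ⊕ q′
  ⊕-cong {p} {p′} {q} {q′} (mk≋ p≈p′) (mk≋ q≈q′) = mk≋ λ e →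
    trans (coeff-⊕ p q e) (trans (cong₂ ℤ._+_ (p≈p′ e) (q≈q′ e)) (sym (coeff-⊕ p′ q′ e)))

  ⊕-congˡ : ∀ p {q q′} → q ≋ q′ → p ⊕ q ≋ p ⊕ q′
  ⊕-congˡ p = ⊕-cong (≋-refl {p})

  ⊕-congʳ : ∀ {p p′} q → p ≋ p′ → p ⊕ q ≋ p′ ⊕ q
  ⊕-congʳ q p≋p′ = ⊕-cong p≋p′ (≋-refl {q})

  ⊕-assoc : ∀ p q r → (p ⊕ q) ⊕ r ≋ p ⊕ (q ⊕ r)
  ⊕-assoc p q r = mk≋ (λ e → cong (λ s → coeff s e) (++-assoc p q r))

  ⊕-comm : ∀ p q → p ⊕ q ≋ q ⊕ p
  ⊕-comm p q = mk≋ λ e →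
    trans (coeff-⊕ p q e) (trans (ℤP.+-comm (coeff p e) (coeff q e)) (sym (coeff-⊕ q p e)))

  ⊕-identityˡ : ∀ p → 0L ⊕ p ≋ p
  ⊕-identityˡ p = ≋-refl

  ⊕-identityʳ : ∀ p → p ⊕ 0L ≋ p
  ⊕-identityʳ p = mk≋ (λ e → trans (coeff-⊕ p 0L e) (ℤP.+-identityʳ (coeff p e)))

  -ᴸ‿inverseˡ : ∀ p → (-ᴸ p) ⊕ p ≋ 0L
  -ᴸ‿inverseˡ p = mk≋ λ e →
    trans (coeff-⊕ (-ᴸ p) p e) (trans (cong (ℤ._+ coeff p e) (coeff-neg p e)) (ℤP.+-inverseˡ (coeff p e)))

  -ᴸ‿inverseʳ : ∀ p → p ⊕ (-ᴸ p) ≋ 0L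
  -ᴸ‿inverseʳ p = ≋-trans (⊕-comm p (-ᴸ p)) (-ᴸ‿inverseˡ p)

  -ᴸ‿cong : ∀ {p q} → p ≋ q → -ᴸ p ≋ -ᴸ q
  -ᴸ‿cong {p} {q} (mk≋ p≈q) = mk≋ λ e →
    trans (coeff-neg p e) (trans (cong ℤ.-_ (p≈q e)) (sym (coeff-neg q e)))

  ⊗-congˡ : ∀ p {q q′} → q ≋ q′ → p ⊗ q ≋ p ⊗ q′
  ⊗-congˡ p {q} {q′} (mk≋ q≈q′) = mk≋ λ e →
    trans (coeff-⊗-convolution p q e)
      (trans (ℤΣ.∑-cong p (λ s → cong (proj₁ s ℤ.*_) (q≈q′ (proj₂ s \\ᵉ e))))
        (sym (coeff-⊗-convolution p q′ e)))

  ⊗-comm : ∀ p q → p ⊗ q ≋ q ⊗ p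
  ⊗-comm p q = mk≋ λ e → begin
    coeff (p ⊗ q) e
      ≡⟨ coeff-⊗ p q e ⟩
    ∑ p (λ s → ∑ q (λ t → termCoeff (s ·ᵗ t) e))
      ≡⟨ ℤΣ.∑-comm p q _ ⟩
    ∑ q (λ t → ∑ p (λ s → termCoeff (s ·ᵗ t) e))
      ≡⟨ ℤΣ.∑-cong q (λ t → ℤΣ.∑-cong p (λ s → cong (λ u → termCoeff u e) (·ᵗ-comm s t))) ⟩
    ∑ q (λ t → ∑ p (λ s → termCoeff (t ·ᵗ s) e))
      ≡⟨ coeff-⊗ q p e ⟨
    coeff (q ⊗ p) e ∎
    where
    open ≡-Reasoning
    ·ᵗ-comm : ∀ s t → s ·ᵗ t ≡ t ·ᵗ s
    ·ᵗ-comm (a , f) (b , g) = cong₂ _,_ (ℤP.*-comm a b) (zipWith-comm ℤP.+-comm f g)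

  ⊗-assoc : ∀ p q r → (p ⊗ q) ⊗ r ≋ p ⊗ (q ⊗ r)
  ⊗-assoc p q r = mk≋ λ e → begin
    coeff ((p ⊗ q) ⊗ r) e
      ≡⟨ coeff-⊗ (p ⊗ q) r e ⟩
    ∑ (p ⊗ q) (λ w → ∑ r (λ u → termCoeff (w ·ᵗ u) e))
      ≡⟨ ℤΣ.∑-concatMap (λ s → map (s ·ᵗ_) q) p _ ⟩
    ∑ p (λ s → ∑ (map (s ·ᵗ_) q) (λ w → ∑ r (λ u → termCoeff (w ·ᵗ u) e)))
      ≡⟨ ℤΣ.∑-cong p (λ s → ℤΣ.∑-map (s ·ᵗ_) q _) ⟩
    ∑ p (λ s → ∑ q (λ t → ∑ r (λ u → termCoeff ((s ·ᵗ t) ·ᵗ u) e)))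
      ≡⟨ ℤΣ.∑-cong p (λ s → ℤΣ.∑-cong q (λ t → ℤΣ.∑-cong r (λ u → cong (λ v → termCoeff v e) (·ᵗ-assoc s t u)))) ⟩
    ∑ p (λ s → ∑ q (λ t → ∑ r (λ u → termCoeff (s ·ᵗ (t ·ᵗ u)) e)))
      ≡⟨ ℤΣ.∑-cong p (λ s → ℤΣ.∑-cong q (λ t → ℤΣ.∑-map (t ·ᵗ_) r _)) ⟨
    ∑ p (λ s → ∑ q (λ t → ∑ (map (t ·ᵗ_) r) (λ w → termCoeff (s ·ᵗ w) e)))
      ≡⟨ ℤΣ.∑-cong p (λ s → ℤΣ.∑-concatMap (λ t → map (t ·ᵗ_) r) q _) ⟨
    ∑ p (λ s → ∑ (q ⊗ r) (λ w → termCoeff (s ·ᵗ w) e))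
      ≡⟨ coeff-⊗ p (q ⊗ r) e ⟨
    coeff (p ⊗ (q ⊗ r)) e ∎
    where
    open ≡-Reasoning
    ·ᵗ-assoc : ∀ s t u → (s ·ᵗ t) ·ᵗ u ≡ s ·ᵗ (t ·ᵗ u)
    ·ᵗ-assoc (a , f) (b , g) (c , h) = cong₂ _,_ (ℤP.*-assoc a b c) (zipWith-assoc ℤP.+-assoc f g h)

  ⊗-distribˡ : ∀ p q r → p ⊗ (q ⊕ r) ≋ (p ⊗ q) ⊕ (p ⊗ r)
  ⊗-distribˡ p q r = mk≋ λ e → begin
    coeff (p ⊗ (q ⊕ r)) e                                           ≡⟨ coeff-⊗ p (q ++ r) e ⟩
    ∑ p (λ s → ∑ (q ++ r) (λ t → termCoeff (s ·ᵗ t) e))             ≡⟨ ℤΣ.∑-cong p (λ s → ℤΣ.∑-++ q r _) ⟩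
    ∑ p (λ s → ∑ q (λ t → termCoeff (s ·ᵗ t) e) ℤ.+ ∑ r (λ t → termCoeff (s ·ᵗ t) e))
      ≡⟨ ℤΣ.∑-distrib-+ p _ _ ⟩
    ∑ p (λ s → ∑ q (λ t → termCoeff (s ·ᵗ t) e)) ℤ.+ ∑ p (λ s → ∑ r (λ t → termCoeff (s ·ᵗ t) e))
      ≡⟨ cong₂ ℤ._+_ (coeff-⊗ p q e) (coeff-⊗ p r e) ⟨
    coeff (p ⊗ q) e ℤ.+ coeff (p ⊗ r) e                              ≡⟨ coeff-⊕ (p ⊗ q) (p ⊗ r) e ⟨
    coeff ((p ⊗ q) ⊕ (p ⊗ r)) e                                      ∎
    where open ≡-Reasoning

  zeroᵉ : Exp
  zeroᵉ = Vec.replicate m (+ 0)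

  ⊗-identityˡ : ∀ p → 1L ⊗ p ≋ p
  ⊗-identityˡ p = mk≋ λ e → begin
    coeff (1L ⊗ p) e                          ≡⟨ coeff-⊗-convolution 1L p e ⟩
    + 1 ℤ.* coeff p (zeroᵉ \\ᵉ e) ℤ.+ + 0     ≡⟨ ℤP.+-identityʳ _ ⟩
    + 1 ℤ.* coeff p (zeroᵉ \\ᵉ e)             ≡⟨ ℤP.*-identityˡ _ ⟩
    coeff p (zeroᵉ \\ᵉ e)                     ≡⟨ cong (coeff p) (zipWith-identityˡ ℤP.+-identityˡ e) ⟩
    coeff p e                                 ∎
    where
    open ≡-Reasoning

  ⊗-cong : ∀ {p p′ q q′} → p ≋ p′ → q ≋ q′ → p ⊗ q ≋ p′ ⊗ q′
  ⊗-cong {p} {p′} {q} {q′} p≋p′ q≋q′ =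
    ≋-trans (⊗-congˡ p q≋q′) (≋-trans (⊗-comm p q′) (≋-trans (⊗-congˡ q′ p≋p′) (⊗-comm q′ p′)))

  ⊗-congʳ : ∀ {p p′} q → p ≋ p′ → p ⊗ q ≋ p′ ⊗ q
  ⊗-congʳ q p≋p′ = ⊗-cong p≋p′ (≋-refl {q})

  ⊗-identityʳ : ∀ p → p ⊗ 1L ≋ p
  ⊗-identityʳ p = ≋-trans (⊗-comm p 1L) (⊗-identityˡ p)

  ⊗-distribʳ : ∀ p q r → (q ⊕ r) ⊗ p ≋ (q ⊗ p) ⊕ (r ⊗ p)
  ⊗-distribʳ p q r =
    ≋-trans (⊗-comm (q ⊕ r) p) (≋-trans (⊗-distribˡ p q r) (⊕-cong (⊗-comm p q) (⊗-comm p r)))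

  isCommutativeRing : IsCommutativeRing _≋_ _⊕_ _⊗_ -ᴸ_ 0L 1L
  isCommutativeRing = record
    { isRing = record
      { +-isAbelianGroup = record
        { isGroup = record
          { isMonoid = record
            { isSemigroup = record
              { isMagma = record
                { isEquivalence = record { refl = ≋-refl ; sym = ≋-sym ; trans = ≋-trans }
                ; ∙-cong = ⊕-cong }
              ; assoc = ⊕-assoc }
            ; identity = ⊕-identityˡ , ⊕-identityʳ }
          ; inverse = -ᴸ‿inverseˡ , -ᴸ‿inverseʳ
          ; ⁻¹-cong = -ᴸ‿cong }
        ; comm = ⊕-comm }
      ; *-cong = ⊗-cong
      ; *-assoc = ⊗-assoc
      ; *-identity = ⊗-identityˡ , ⊗-identityʳ
      ; distrib = ⊗-distribˡ , ⊗-distribʳ }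
    ; *-comm = ⊗-comm }

  laurentRing : CommutativeRing 0ℓ 0ℓ
  laurentRing = record { isCommutativeRing = isCommutativeRing }

  coeff-constL : ∀ a e → coeff (constL a) e ≡ termCoeff (a , zeroᵉ) e
  coeff-constL a e = trans (coeff-∑ (constL a) e) (ℤP.+-identityʳ _)

  constL-+ : ∀ a b → constL (a ℤ.+ b) ≋ constL a ⊕ constL b
  constL-+ a b = mk≋ λ e → begin
    coeff (constL (a ℤ.+ b)) e                     ≡⟨ coeff-constL (a ℤ.+ b) e ⟩
    termCoeff (a ℤ.+ b , zeroᵉ) e                  ≡⟨ termCoeff-+ a b zeroᵉ e ⟩
    termCoeff (a , zeroᵉ) e ℤ.+ termCoeff (b , zeroᵉ) e ≡⟨ cong₂ ℤ._+_ (coeff-constL a e) (coeff-constL b e) ⟨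
    coeff (constL a) e ℤ.+ coeff (constL b) e      ≡⟨ coeff-⊕ (constL a) (constL b) e ⟨
    coeff (constL a ⊕ constL b) e                  ∎
    where open ≡-Reasoning

  constL-* : ∀ a b → constL (a ℤ.* b) ≋ constL a ⊗ constL b
  constL-* a b = mk≋ λ e → begin
    coeff (constL (a ℤ.* b)) e
      ≡⟨ coeff-constL (a ℤ.* b) e ⟩
    termCoeff (a ℤ.* b , zeroᵉ) e
      ≡⟨ cong (λ z → termCoeff (a ℤ.* b , z) e) (zipWith-identityˡ ℤP.+-identityˡ zeroᵉ) ⟨
    termCoeff ((a , zeroᵉ) ·ᵗ (b , zeroᵉ)) e
      ≡⟨ ℤP.+-identityʳ _ ⟨
    termCoeff ((a , zeroᵉ) ·ᵗ (b , zeroᵉ)) e ℤ.+ + 0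
      ≡⟨ ℤP.+-identityʳ _ ⟨
    (termCoeff ((a , zeroᵉ) ·ᵗ (b , zeroᵉ)) e ℤ.+ + 0) ℤ.+ + 0
      ≡⟨ coeff-⊗ (constL a) (constL b) e ⟨
    coeff (constL a ⊗ constL b) e ∎
    where open ≡-Reasoning

  constL-neg : ∀ a → constL (ℤ.- a) ≋ -ᴸ constL a
  constL-neg a = mk≋ λ e → begin
    coeff (constL (ℤ.- a)) e           ≡⟨ coeff-constL (ℤ.- a) e ⟩
    termCoeff (ℤ.- a , zeroᵉ) e        ≡⟨ termCoeff-neg a zeroᵉ e ⟩
    ℤ.- termCoeff (a , zeroᵉ) e        ≡⟨ cong ℤ.-_ (coeff-constL a e) ⟨
    ℤ.- coeff (constL a) e             ≡⟨ coeff-neg (constL a) e ⟨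
    coeff (-ᴸ constL a) e              ∎
    where open ≡-Reasoning

  constL-0 : constL (+ 0) ≋ 0L
  constL-0 = mk≋ λ e → trans (coeff-constL (+ 0) e) (termCoeff-zero zeroᵉ e)
    where
    termCoeff-zero : ∀ f e → termCoeff (+ 0 , f) e ≡ + 0
    termCoeff-zero f e with ≡-dec ℤ._≟_ f e
    ... | yes _ = refl
    ... | no  _ = refl

  1L≉0L : ¬ (1L ≋ 0L)
  1L≉0L (mk≋ 1≈0) = contradiction (trans (sym (termCoeff-self (+ 1) zeroᵉ))
    (trans (sym (coeff-constL (+ 1) zeroᵉ)) (1≈0 zeroᵉ))) λ ()

  V⊗Vinv : ∀ i → V i ⊗ Vinv i ≋ 1L
  V⊗Vinv i = mk≋ λ e → cong (λ f → coeff [ (+ 1 , f) ] e) (exponents-cancel _ _ (opposite (+ 1)))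
    where
    opposite : ∀ a {n} (j : Fin n) →
               (if toℕ j ≡ᵇ i then a else + 0) ℤ.+ (if toℕ j ≡ᵇ i then ℤ.- a else + 0) ≡ + 0
    opposite a j with toℕ j ≡ᵇ i
    ... | true  = ℤP.+-inverseʳ a
    ... | false = refl
    exponents-cancel : ∀ {n} (f g : Fin n → ℤ) → (∀ j → f j ℤ.+ g j ≡ + 0) →
                       Vec.tabulate f +ᵉ Vec.tabulate g ≡ Vec.replicate n (+ 0)
    exponents-cancel {zero}  f g f+g≡0 = refl
    exponents-cancel {suc n} f g f+g≡0 =
      cong₂ _∷_ (f+g≡0 Fin.zero) (exponents-cancel (f ∘ Fin.suc) (g ∘ Fin.suc) (f+g≡0 ∘ Fin.suc))

  constL-morphism : ℤ.+-*-rawRing -Raw-AlmostCommutative⟶ fromCommutativeRing laurentRing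
  constL-morphism = record
    { ⟦_⟧    = constL
    ; +-homo = constL-+
    ; *-homo = constL-*
    ; -‿homo = constL-neg
    ; 0-homo = constL-0
    ; 1-homo = ≋-refl
    }

  -- Equal integer coefficients are recognised, which lets the solver cancel terms.
  constL-≟ : WeaklyDecidable (λ a b → constL a ≋ constL b)
  constL-≟ a b with a ℤ.≟ b
  ... | yes refl = just ≋-refl
  ... | no  _    = nothing

  module Solver = RingSolver ℤ.+-*-rawRing (fromCommutativeRing laurentRing) constL-morphism constL-≟

module PeakValleyInverse where

  open import Data.Bool using (_∧_; _∨_; not)
  open import Data.Bool.Properties using (∧-identityʳ; not-involutive; T-∧)
  open import Function.Bundles using (Equivalence)
  open import Data.Nat using (_*_; _%_)
  import Data.Nat.Properties as ℕP
  open ℕP using (≤-refl; ≤-antisym; ≤-pred; <⇒≱; ≮⇒≥; <⇒<ᵇ; <⇒≤; <⇒≢; n≤1+n; n<1+n; m≤n⇒m≤1+n; <-cmp)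
  open import Data.Nat.DivMod using ([m+n]%n≡m%n)
  open import Relation.Binary.Definitions using (tri<; tri≈; tri>)
  open import Relation.Nullary.Decidable using (⌊_⌋; toWitness)
  open ≡ using (refl; sym; trans; cong; cong₂; subst; ≢-sym)

  data Residue : Set where
    r0 r1 r2 : Residue

  residue : ℕ → Residue
  residue 0                   = r0
  residue 1                   = r1
  residue 2                   = r2
  residue (suc (suc (suc n))) = residue n

  residueValue : Residue → ℕ
  residueValue r0 = 0
  residueValue r1 = 1
  residueValue r2 = 2

  next prev : Residue → Residue
  next r0 = r1
  next r1 = r2
  next r2 = r0
  prev r0 = r2
  prev r1 = r0
  prev r2 = r1

  prev-next : ∀ r → prev (next r) ≡ r
  prev-next r0 = refl
  prev-next r1 = refl
  prev-next r2 = refl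

  n%3≡residue : ∀ n → n % 3 ≡ residueValue (residue n)
  n%3≡residue 0                   = refl
  n%3≡residue 1                   = refl
  n%3≡residue 2                   = refl
  n%3≡residue (suc (suc (suc n))) = trans (cong (_% 3) (ℕP.+-comm 3 n)) (trans ([m+n]%n≡m%n n 3) (n%3≡residue n))

  residue-suc : ∀ n → residue (suc n) ≡ next (residue n)
  residue-suc 0                   = refl
  residue-suc 1                   = refl
  residue-suc 2                   = refl
  residue-suc (suc (suc (suc n))) = residue-suc n

  residue-3* : ∀ k → residue (3 * k) ≡ r0
  residue-3* zero    = refl
  residue-3* (suc k) = trans (cong residue (ℕP.*-suc 3 k)) (residue-3* k)

  -- With lt = (x <ᵇ y) and gt = (y <ᵇ x) for consecutive entries x, y: the
  -- condition x imposes on its right neighbour, and y on its left neighbour.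
  rightCond leftCond : Residue → Bool → Bool → Bool
  rightCond r0 lt gt = true
  rightCond r1 lt gt = lt
  rightCond r2 lt gt = gt
  leftCond  r0 lt gt = true
  leftCond  r1 lt gt = gt
  leftCond  r2 lt gt = lt

  admissible : Residue → Residue → Bool → Bool → Bool
  admissible rx ry lt gt = rightCond rx lt gt ∧ leftCond ry lt gt

  rightOK leftOK : ℕ → ℕ → Bool
  rightOK x y = rightCond (residue x) (x <ᵇ y) (y <ᵇ x)
  leftOK  x y = leftCond (residue y) (x <ᵇ y) (y <ᵇ x)

  infix 4 _⇀_
  _⇀_ : ℕ → ℕ → Bool
  x ⇀ y = admissible (residue x) (residue y) (x <ᵇ y) (y <ᵇ x)

  pvCond≡leftOK∧rightOK : ∀ x y z → pvCond x y z ≡ leftOK x y ∧ rightOK y z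
  pvCond≡leftOK∧rightOK x y z rewrite n%3≡residue y with residue y
  ... | r0 = refl
  ... | r1 = ∧-identityʳ _
  ... | r2 = refl

  admissibleFrom : ℕ → List ℕ → Bool
  admissibleFrom x []      = x ⇀ 0
  admissibleFrom x (y ∷ s) = (x ⇀ y) ∧ admissibleFrom y s

  isModPV3≡admissibleFrom0 : ∀ s → isModPV3 s ≡ admissibleFrom 0 s
  isModPV3≡admissibleFrom0 = windows≡ 0
    where
    head0 : List ℕ → ℕ
    head0 []      = 0
    head0 (y ∷ _) = y
    regroup : ∀ a b c w → a ∧ ((b ∧ c) ∧ w) ≡ (a ∧ b) ∧ (c ∧ w)
    regroup false b     c w = refl
    regroup true  false c w = refl
    regroup true  true  c w = refl
    windows≡ : ∀ x s → rightOK x (head0 s) ∧ windows (x ∷ s ++ [ 0 ]) ≡ admissibleFrom x s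
    windows≡ x []          = refl
    windows≡ x (y ∷ [])    =
      trans (cong (λ b → rightOK x y ∧ (b ∧ true)) (pvCond≡leftOK∧rightOK x y 0))
            (trans (regroup (rightOK x y) (leftOK x y) (rightOK y 0) true) (cong ((x ⇀ y) ∧_) (windows≡ y [])))
    windows≡ x (y ∷ z ∷ s) =
      trans (cong (λ b → rightOK x y ∧ (b ∧ windows (y ∷ z ∷ s ++ [ 0 ]))) (pvCond≡leftOK∧rightOK x y z))
            (trans (regroup (rightOK x y) (leftOK x y) (rightOK y z) _) (cong ((x ⇀ y) ∧_) (windows≡ y (z ∷ s))))

  positive : ℕ → Bool
  positive 0                   = true
  positive 1                   = true
  positive 2                   = false
  positive (suc (suc (suc n))) = not (positive n)

  signOf : Bool → ℤ
  signOf true  = + 1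
  signOf false = ℤ.- + 1

  -- sign n = (−1)^⌊(n + 1)/3⌋
  sign : ℕ → ℤ
  sign n = signOf (positive n)

  -- The sign of n + 1 from that of n, and of n − 1 from that of n, given the residue of n.
  flipAfter flipBefore : Bool → Residue → Bool
  flipAfter  p r1 = not p
  flipAfter  p r0 = p
  flipAfter  p r2 = p
  flipBefore p r2 = not p
  flipBefore p r0 = p
  flipBefore p r1 = p

  positive-suc : ∀ n → positive (suc n) ≡ flipAfter (positive n) (residue n)
  positive-suc 0                   = refl
  positive-suc 1                   = refl
  positive-suc 2                   = refl
  positive-suc (suc (suc (suc n))) = trans (cong not (positive-suc n)) (not-flipAfter (positive n) (residue n))
    where
    not-flipAfter : ∀ p r → not (flipAfter p r) ≡ flipAfter (not p) r
    not-flipAfter p r0 = refl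
    not-flipAfter p r1 = refl
    not-flipAfter p r2 = refl

  flipBefore-flipAfter : ∀ p r → flipBefore (flipAfter p r) (next r) ≡ p
  flipBefore-flipAfter p r0 = refl
  flipBefore-flipAfter p r1 = not-involutive p
  flipBefore-flipAfter p r2 = refl

  toℤ : Bool → ℤ
  toℤ true  = + 1
  toℤ false = + 0

  belowTerm : ℕ → ℕ → ℤ
  belowTerm zero    l = + 0
  belowTerm (suc h) l = ℤ.- sign h ℤ.* toℤ (h ⇀ l)

  -- Entry (h, l) of T · (sign x · [x ⇀ l])ₓₗ, T the transfer matrix of height ≤ K,
  -- after removing the factor V₁⁻¹ ⋯ V_h⁻¹ common to the three terms.
  transferColumn : ℕ → ℕ → ℕ → ℤ
  transferColumn K h l =
    (if h <ᵇ K then ℤ.- sign (suc h) ℤ.* toℤ (suc h ⇀ l) else + 0) ℤ.+ sign h ℤ.* toℤ (h ⇀ l) ℤ.+ belowTerm h l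

  data Region : Set where
    l<h-1 l=h-1 l=h l=h+1 l>h+1 : Region

  data Offset : Set where
    h+1 h+0 h-1 : Offset

  -- Whether x < l, resp. l < x, for x = h + d when l lies in region ρ relative to h.
  x<l l<x : Offset → Region → Bool
  x<l h+1 l>h+1 = true
  x<l h+1 _     = false
  x<l h+0 l=h+1 = true
  x<l h+0 l>h+1 = true
  x<l h+0 _     = false
  x<l h-1 l<h-1 = false
  x<l h-1 l=h-1 = false
  x<l h-1 _     = true
  l<x h+1 l=h+1 = false
  l<x h+1 l>h+1 = false
  l<x h+1 _     = true
  l<x h+0 l<h-1 = true
  l<x h+0 l=h-1 = true
  l<x h+0 _     = false
  l<x h-1 l<h-1 = true
  l<x h-1 _     = false

  _==_ : Residue → Residue → Bool
  r0 == r0 = true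
  r1 == r1 = true
  r2 == r2 = true
  _  == _  = false

  ==-refl : ∀ r → T (r == r)
  ==-refl r0 = _
  ==-refl r1 = _
  ==-refl r2 = _

  residuesFit : Residue → Residue → Region → Bool
  residuesFit r rl l=h-1 = rl == prev r
  residuesFit r rl l=h   = rl == r
  residuesFit r rl l=h+1 = rl == next r
  residuesFit r rl _     = true

  isL=h : Region → Bool
  isL=h l=h = true
  isL=h _   = false

  record InRegion (h l : ℕ) (ρ : Region) : Set where
    field
      [h+1<l] : (suc h <ᵇ l) ≡ x<l h+1 ρ
      [l<h+1] : (l <ᵇ suc h) ≡ l<x h+1 ρ
      [h<l]   : (h <ᵇ l) ≡ x<l h+0 ρ
      [l<h]   : (l <ᵇ h) ≡ l<x h+0 ρ
      [h-1<l] : ∀ {h′} → h ≡ suc h′ → (h′ <ᵇ l) ≡ x<l h-1 ρ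
      [l<h-1] : ∀ {h′} → h ≡ suc h′ → (l <ᵇ h′) ≡ l<x h-1 ρ
      [l≡h]   : (l ≡ᵇ h) ≡ isL=h ρ
      fits    : T (residuesFit (residue h) (residue l) ρ)

  inRegion-l<h-1 : ∀ {h′ l} → l < h′ → InRegion (suc h′) l l<h-1
  inRegion-l<h-1 l<h′ = record
    { [h+1<l] = <ᵇ-false (m≤n⇒m≤1+n (m≤n⇒m≤1+n (<⇒≤ l<h′)))
    ; [l<h+1] = <ᵇ-true (m≤n⇒m≤1+n (m≤n⇒m≤1+n l<h′))
    ; [h<l]   = <ᵇ-false (m≤n⇒m≤1+n (<⇒≤ l<h′))
    ; [l<h]   = <ᵇ-true (m≤n⇒m≤1+n l<h′)
    ; [h-1<l] = λ { refl → <ᵇ-false (<⇒≤ l<h′) }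
    ; [l<h-1] = λ { refl → <ᵇ-true l<h′ }
    ; [l≡h]   = ≡ᵇ-false (<⇒≢ (m≤n⇒m≤1+n l<h′))
    ; fits    = _ }

  inRegion-l=h-1 : ∀ h′ → InRegion (suc h′) h′ l=h-1
  inRegion-l=h-1 h′ = record
    { [h+1<l] = <ᵇ-false (m≤n⇒m≤1+n (n≤1+n h′))
    ; [l<h+1] = <ᵇ-true (m≤n⇒m≤1+n (n<1+n h′))
    ; [h<l]   = <ᵇ-false (n≤1+n h′)
    ; [l<h]   = <ᵇ-true (n<1+n h′)
    ; [h-1<l] = λ { refl → <ᵇ-false (≤-refl {h′}) }
    ; [l<h-1] = λ { refl → <ᵇ-false (≤-refl {h′}) }
    ; [l≡h]   = ≡ᵇ-false (<⇒≢ (n<1+n h′))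
    ; fits    = subst (λ r → T (residue h′ == prev r)) (sym (residue-suc h′))
                  (subst (λ r → T (residue h′ == r)) (sym (prev-next (residue h′))) (==-refl (residue h′))) }

  inRegion-l=h : ∀ h → InRegion h h l=h
  inRegion-l=h h = record
    { [h+1<l] = <ᵇ-false (n≤1+n h)
    ; [l<h+1] = <ᵇ-true (n<1+n h)
    ; [h<l]   = <ᵇ-false (≤-refl {h})
    ; [l<h]   = <ᵇ-false (≤-refl {h})
    ; [h-1<l] = λ { {h′} refl → <ᵇ-true (n<1+n h′) }
    ; [l<h-1] = λ { {h′} refl → <ᵇ-false (n≤1+n h′) }
    ; [l≡h]   = ≡ᵇ-refl h
    ; fits    = ==-refl (residue h) }

  inRegion-l=h+1 : ∀ h → InRegion h (suc h) l=h+1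
  inRegion-l=h+1 h = record
    { [h+1<l] = <ᵇ-false (≤-refl {suc h})
    ; [l<h+1] = <ᵇ-false (≤-refl {suc h})
    ; [h<l]   = <ᵇ-true (n<1+n h)
    ; [l<h]   = <ᵇ-false (n≤1+n h)
    ; [h-1<l] = λ { {h′} refl → <ᵇ-true (m≤n⇒m≤1+n (n<1+n h′)) }
    ; [l<h-1] = λ { {h′} refl → <ᵇ-false (m≤n⇒m≤1+n (n≤1+n h′)) }
    ; [l≡h]   = ≡ᵇ-false (≢-sym (<⇒≢ (n<1+n h)))
    ; fits    = subst (λ r → T (r == next (residue h))) (sym (residue-suc h)) (==-refl (next (residue h))) }

  inRegion-l>h+1 : ∀ {h l} → suc h < l → InRegion h l l>h+1
  inRegion-l>h+1 h+1<l = record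
    { [h+1<l] = <ᵇ-true h+1<l
    ; [l<h+1] = <ᵇ-false (<⇒≤ h+1<l)
    ; [h<l]   = <ᵇ-true (<⇒≤ h+1<l)
    ; [l<h]   = <ᵇ-false (<⇒≤ (<⇒≤ h+1<l))
    ; [h-1<l] = λ { refl → <ᵇ-true (m≤n⇒m≤1+n (<⇒≤ h+1<l)) }
    ; [l<h-1] = λ { refl → <ᵇ-false (m≤n⇒m≤1+n (<⇒≤ (<⇒≤ h+1<l))) }
    ; [l≡h]   = ≡ᵇ-false (≢-sym (<⇒≢ (<⇒≤ h+1<l)))
    ; fits    = _ }

  region : ∀ h l → Σ Region (InRegion h l)
  region h l with <-cmp l h
  region zero     l | tri< () _ _
  region (suc h′) l | tri< l<h _ _ with <-cmp l h′
  ... | tri< l<h′ _ _ = l<h-1 , inRegion-l<h-1 l<h′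
  ... | tri≈ _ refl _ = l=h-1 , inRegion-l=h-1 h′
  ... | tri> _ _ h′<l = contradiction (≤-pred l<h) (<⇒≱ h′<l)
  region h l | tri≈ _ refl _ = l=h , inRegion-l=h h
  region h l | tri> _ _ h<l with <-cmp l (suc h)
  ... | tri< l<h+1 _ _ = contradiction (≤-pred l<h+1) (<⇒≱ h<l)
  ... | tri≈ _ refl _  = l=h+1 , inRegion-l=h+1 h
  ... | tri> _ _ h+1<l = l>h+1 , inRegion-l>h+1 h+1<l

  -- transferColumn K h l depends on h and l only through the data below, so
  -- the identity transferColumn≡diagonal reduces to a check of finitely many cases.
  abstractEntry : Residue → Residue → Region → Offset → ℤ
  abstractEntry rx rl ρ d = toℤ (admissible rx rl (x<l d ρ) (l<x d ρ))

  abstractColumn : Bool → Residue → Residue → Region → Bool → Bool → ℤ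
  abstractColumn pos r rl ρ notTop notBottom =
    (if notTop then ℤ.- signOf (flipAfter pos r) ℤ.* abstractEntry (next r) rl ρ h+1 else + 0)
    ℤ.+ signOf pos ℤ.* abstractEntry r rl ρ h+0
    ℤ.+ (if notBottom then ℤ.- signOf (flipBefore pos r) ℤ.* abstractEntry (prev r) rl ρ h-1 else + 0)

  -- At the top row h = K ≡ 0 (mod 3) and l ≤ h; at the bottom row h = 0 and l ≥ h.
  consistent : Residue → Residue → Region → Bool → Bool → Bool
  consistent r rl ρ notTop notBottom =
    residuesFit r rl ρ ∧ (notTop ∨ (r == r0 ∧ not (x<l h+0 ρ))) ∧ (notBottom ∨ (r == r0 ∧ not (l<x h+0 ρ)))

  expected : Bool → Region → ℤ
  expected pos ρ = if isL=h ρ then signOf pos else + 0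

  record ∀-Bool (P : Bool → Set) : Set where
    field at-true : P true
          at-false : P false

  record ∀-Residue (P : Residue → Set) : Set where
    field at-r0 : P r0
          at-r1 : P r1
          at-r2 : P r2

  record ∀-Region (P : Region → Set) : Set where
    field at-l<h-1 : P l<h-1
          at-l=h-1 : P l=h-1
          at-l=h   : P l=h
          at-l=h+1 : P l=h+1
          at-l>h+1 : P l>h+1

  open ∀-Bool
  open ∀-Residue
  open ∀-Region

  ∀-Bool-elim : ∀ {P} → ∀-Bool P → ∀ b → P b
  ∀-Bool-elim c true  = at-true c
  ∀-Bool-elim c false = at-false c

  ∀-Residue-elim : ∀ {P} → ∀-Residue P → ∀ r → P r
  ∀-Residue-elim c r0 = at-r0 c
  ∀-Residue-elim c r1 = at-r1 c
  ∀-Residue-elim c r2 = at-r2 c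

  ∀-Region-elim : ∀ {P} → ∀-Region P → ∀ ρ → P ρ
  ∀-Region-elim c l<h-1 = at-l<h-1 c
  ∀-Region-elim c l=h-1 = at-l=h-1 c
  ∀-Region-elim c l=h   = at-l=h c
  ∀-Region-elim c l=h+1 = at-l=h+1 c
  ∀-Region-elim c l>h+1 = at-l>h+1 c

  caseHolds : Bool → Residue → Residue → Region → Bool → Bool → Bool
  caseHolds pos r rl ρ notTop notBottom =
    not (consistent r rl ρ notTop notBottom) ∨
    ⌊ abstractColumn pos r rl ρ notTop notBottom ℤ.≟ expected pos ρ ⌋

  -- Every field is T of a closed Boolean, which evaluates to true, so η fills in all cases.
  allCasesHold : ∀-Bool λ pos → ∀-Residue λ r → ∀-Residue λ rl → ∀-Region λ ρ →
                 ∀-Bool λ notTop → ∀-Bool λ notBottom → T (caseHolds pos r rl ρ notTop notBottom)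
  allCasesHold = _

  abstractColumn≡expected : ∀ pos r rl ρ notTop notBottom → T (consistent r rl ρ notTop notBottom) →
                            abstractColumn pos r rl ρ notTop notBottom ≡ expected pos ρ
  abstractColumn≡expected pos r rl ρ notTop notBottom isConsistent =
    toWitness (implication case isConsistent)
    where
    implication : ∀ {a b} → T (not a ∨ b) → T a → T b
    implication {true} b _ = b
    case : T (caseHolds pos r rl ρ notTop notBottom)
    case = ∀-Bool-elim (∀-Bool-elim (∀-Region-elim (∀-Residue-elim (∀-Residue-elim
             (∀-Bool-elim allCasesHold pos) r) rl) ρ) notTop) notBottom

  module _ (k : ℕ) where

    private
      K : ℕ
      K = 3 * k

    transferColumn≡abstract : ∀ h l {ρ} → InRegion h l ρ →
      transferColumn K h l ≡ abstractColumn (positive h) (residue h) (residue l) ρ (h <ᵇ K) (0 <ᵇ h)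
    transferColumn≡abstract h l {ρ} inρ =
      cong₂ ℤ._+_ (cong₂ ℤ._+_ (cong (λ z → if h <ᵇ K then z else + 0) upper) middle) (lower h inρ)
      where
      open InRegion
      upper : ℤ.- sign (suc h) ℤ.* toℤ (suc h ⇀ l)
              ≡ ℤ.- signOf (flipAfter (positive h) (residue h))
                  ℤ.* abstractEntry (next (residue h)) (residue l) ρ h+1
      upper rewrite positive-suc h | residue-suc h | [h+1<l] inρ | [l<h+1] inρ = refl
      middle : sign h ℤ.* toℤ (h ⇀ l) ≡ signOf (positive h) ℤ.* abstractEntry (residue h) (residue l) ρ h+0
      middle rewrite [h<l] inρ | [l<h] inρ = refl
      lower : ∀ h → InRegion h l ρ →
              belowTerm h l ≡ (if 0 <ᵇ h then ℤ.- signOf (flipBefore (positive h) (residue h))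
                                                 ℤ.* abstractEntry (prev (residue h)) (residue l) ρ h-1
                                             else + 0)
      lower zero     inρ = refl
      lower (suc h′) inρ rewrite positive-suc h′ | residue-suc h′ | flipBefore-flipAfter (positive h′) (residue h′)
        | prev-next (residue h′) | [h-1<l] inρ refl | [l<h-1] inρ refl = refl

    consistent-at : ∀ h l {ρ} → h ≤ K → l ≤ K → InRegion h l ρ →
                    T (consistent (residue h) (residue l) ρ (h <ᵇ K) (0 <ᵇ h))
    consistent-at h l {ρ} h≤K l≤K inρ = Equivalence.from T-∧ (fits inρ , Equivalence.from T-∧ (top , bottom inρ))
      where
      open InRegion
      top : T ((h <ᵇ K) ∨ (residue h == r0 ∧ not (x<l h+0 ρ)))
      top with h <ᵇ K in h<ᵇK
      ... | true  = _
      ... | false with ≤-antisym h≤K (≮⇒≥ (λ h<K → subst T h<ᵇK (<⇒<ᵇ h<K)))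
      ... | refl rewrite residue-3* k | sym ([h<l] inρ) | <ᵇ-false l≤K = _
      bottom : ∀ {h} → InRegion h l ρ → T ((0 <ᵇ h) ∨ (residue h == r0 ∧ not (l<x h+0 ρ)))
      bottom {zero}  inρ rewrite sym ([l<h] inρ) = _
      bottom {suc _} _   = _

    transferColumn≡diagonal : ∀ h l → h ≤ K → l ≤ K → transferColumn K h l ≡ (if l ≡ᵇ h then sign h else + 0)
    transferColumn≡diagonal h l h≤K l≤K with region h l
    ... | ρ , inρ = begin
      transferColumn K h l
        ≡⟨ transferColumn≡abstract h l inρ ⟩
      abstractColumn (positive h) (residue h) (residue l) ρ (h <ᵇ K) (0 <ᵇ h)
        ≡⟨ abstractColumn≡expected (positive h) (residue h) (residue l) ρ (h <ᵇ K) (0 <ᵇ h)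
                                   (consistent-at h l h≤K l≤K inρ) ⟩
      expected (positive h) ρ
        ≡⟨ cong (λ b → if b then sign h else + 0) (InRegion.[l≡h] inρ) ⟨
      (if l ≡ᵇ h then sign h else + 0) ∎
      where open ≡.≡-Reasoning

module IntegerShifts where

  open import Data.Integer.Solver using (module +-*-Solver)
  open +-*-Solver

  minus-suc : ∀ t i → t ℤ.- + suc i ≡ (t ℤ.- + 1) ℤ.- + i
  minus-suc t i = solve 2 (λ t i → t :- (con (+ 1) :+ i) := (t :- con (+ 1)) :- i) ≡.refl t (+ i)

  suc-minus-suc : ∀ t j → ℤ.suc (t ℤ.- + suc j) ≡ t ℤ.- + j
  suc-minus-suc t j = solve 2 (λ t j → con (+ 1) :+ (t :- (con (+ 1) :+ j)) := t :- j) ≡.refl t (+ j)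

module CharacteristicPolynomial (m : ℕ) where

  open import Data.Nat using (_*_; pred)
  open import Data.Nat.Properties using (m≤n⇒m≤1+n; *-suc)
  open LaurentRing m
  open CommutativeRing laurentRing using (setoid; +-identityʳ)
  open CoefficientLists laurentRing
  open Solver using (solve; _:=_; _:+_; _:*_; :-_; _:-_; con)
  open import Relation.Binary.Reasoning.Setoid setoid

  -- The leading principal minors of I − x T, T the tridiagonal transfer matrix,
  -- as coefficient lists in x.
  charPoly : ℕ → List (Laurent m)
  charPoly zero          = 1L ∷ []
  charPoly (suc zero)    = charPoly 0 ⊞ (0L ∷ scale (-ᴸ bw 0) (charPoly 0))
  charPoly (suc (suc j)) = charPoly (suc j) ⊞ (0L ∷ scale (-ᴸ bw (suc j)) (charPoly (suc j)))
                                            ⊞ (0L ∷ 0L ∷ scale (-ᴸ λw (suc j)) (charPoly j))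

  charPoly-length : ∀ j → List.length (charPoly j) ≤ suc j
  charPoly-length zero          = s≤s z≤n
  charPoly-length (suc zero)    =
    length-⊞ (charPoly 0) (0L ∷ scale (-ᴸ bw 0) (charPoly 0))
      (s≤s z≤n) (length-shift-scale (-ᴸ bw 0) (charPoly 0) (s≤s z≤n))
  charPoly-length (suc (suc j)) =
    length-⊞ (charPoly (suc j) ⊞ _) _
      (length-⊞ (charPoly (suc j)) _ (m≤n⇒m≤1+n (charPoly-length (suc j)))
        (length-shift-scale (-ᴸ bw (suc j)) (charPoly (suc j)) (charPoly-length (suc j))))
      (s≤s (length-shift-scale (-ᴸ λw (suc j)) (charPoly j) (charPoly-length j)))

  charPoly-head : ∀ j → coeffAt (charPoly j) 0 ≋ 1L
  charPoly-head zero          = ≋-refl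
  charPoly-head (suc zero)    = ⊕-identityʳ 1L
  charPoly-head (suc (suc j)) = begin
    coeffAt (A ⊞ B ⊞ C) 0        ≈⟨ coeffAt-⊞ (A ⊞ B) C 0 ⟩
    coeffAt (A ⊞ B) 0 ⊕ 0L       ≈⟨ +-identityʳ _ ⟩
    coeffAt (A ⊞ B) 0            ≈⟨ coeffAt-⊞ A B 0 ⟩
    coeffAt A 0 ⊕ 0L             ≈⟨ +-identityʳ _ ⟩
    coeffAt A 0                  ≈⟨ charPoly-head (suc j) ⟩
    1L                           ∎
    where
    A B C : List (Laurent m)
    A = charPoly (suc j)
    B = 0L ∷ scale (-ᴸ bw (suc j)) A
    C = 0L ∷ 0L ∷ scale (-ᴸ λw (suc j)) (charPoly j)

  weightedSum-shift-scale : ∀ c p f → weightedSum (0L ∷ scale c p) f ≋ c ⊗ weightedSum p (f ∘ suc)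
  weightedSum-shift-scale c p f = ≋-trans (weightedSum-shift (scale c p) f) (weightedSum-scale c p (f ∘ suc))

  weightedSum-charPoly-suc : ∀ j f →
    weightedSum (charPoly (suc j)) f ≋
      weightedSum (charPoly j) f ⊕ (-ᴸ bw j) ⊗ weightedSum (charPoly j) (f ∘ suc)
                                 ⊕ (-ᴸ λw j) ⊗ weightedSum (charPoly (pred j)) (f ∘ suc ∘ suc)
  weightedSum-charPoly-suc zero f = begin
    weightedSum (charPoly 0 ⊞ (0L ∷ scale (-ᴸ bw 0) (charPoly 0))) f
      ≈⟨ weightedSum-⊞ (charPoly 0) (0L ∷ scale (-ᴸ bw 0) (charPoly 0)) f ⟩
    weightedSum (charPoly 0) f ⊕ weightedSum (0L ∷ scale (-ᴸ bw 0) (charPoly 0)) f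
      ≈⟨ ⊕-congˡ (weightedSum (charPoly 0) f) (weightedSum-shift-scale (-ᴸ bw 0) (charPoly 0) f) ⟩
    weightedSum (charPoly 0) f ⊕ (-ᴸ bw 0) ⊗ weightedSum (charPoly 0) (f ∘ suc)
      ≈⟨ ⊕-identityʳ (weightedSum (charPoly 0) f ⊕ (-ᴸ bw 0) ⊗ weightedSum (charPoly 0) (f ∘ suc)) ⟨
    weightedSum (charPoly 0) f ⊕ (-ᴸ bw 0) ⊗ weightedSum (charPoly 0) (f ∘ suc) ⊕ 0L ∎
  weightedSum-charPoly-suc (suc j) f = begin
    weightedSum (A ⊞ (0L ∷ scale b A) ⊞ (0L ∷ 0L ∷ scale l (charPoly j))) f
      ≈⟨ weightedSum-⊞ (A ⊞ (0L ∷ scale b A)) (0L ∷ 0L ∷ scale l (charPoly j)) f ⟩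
    weightedSum (A ⊞ (0L ∷ scale b A)) f ⊕ weightedSum (0L ∷ 0L ∷ scale l (charPoly j)) f
      ≈⟨ ⊕-cong (weightedSum-⊞ A (0L ∷ scale b A) f)
                (≋-trans (weightedSum-shift (0L ∷ scale l (charPoly j)) f)
                         (weightedSum-shift-scale l (charPoly j) (f ∘ suc))) ⟩
    weightedSum A f ⊕ weightedSum (0L ∷ scale b A) f ⊕ l ⊗ weightedSum (charPoly j) (f ∘ suc ∘ suc)
      ≈⟨ ⊕-congʳ (l ⊗ weightedSum (charPoly j) (f ∘ suc ∘ suc))
                 (⊕-congˡ (weightedSum A f) (weightedSum-shift-scale b A f)) ⟩
    weightedSum A f ⊕ b ⊗ weightedSum A (f ∘ suc) ⊕ l ⊗ weightedSum (charPoly j) (f ∘ suc ∘ suc) ∎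
    where
    A : List (Laurent m)
    A = charPoly (suc j)
    b l : Laurent m
    b = -ᴸ bw (suc j)
    l = -ᴸ λw (suc j)

  leadingCoeff : ℕ → Laurent m
  leadingCoeff j = coeffAt (charPoly j) j

  leadingCoeff-1 : leadingCoeff 1 ≋ (-ᴸ bw 0) ⊗ leadingCoeff 0
  leadingCoeff-1 = ≋-trans (coeffAt-⊞ (charPoly 0) (0L ∷ scale (-ᴸ bw 0) (charPoly 0)) 1)
                           (coeffAt-scale (-ᴸ bw 0) (charPoly 0) 0)

  leadingCoeff-suc-suc : ∀ j →
    leadingCoeff (suc (suc j)) ≋ (-ᴸ bw (suc j)) ⊗ leadingCoeff (suc j) ⊕ (-ᴸ λw (suc j)) ⊗ leadingCoeff j
  leadingCoeff-suc-suc j = begin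
    coeffAt (A ⊞ (0L ∷ scale b A) ⊞ (0L ∷ 0L ∷ scale l (charPoly j))) (suc (suc j))
      ≈⟨ coeffAt-⊞ (A ⊞ (0L ∷ scale b A)) (0L ∷ 0L ∷ scale l (charPoly j)) (suc (suc j)) ⟩
    coeffAt (A ⊞ (0L ∷ scale b A)) (suc (suc j)) ⊕ coeffAt (scale l (charPoly j)) j
      ≈⟨ ⊕-cong (coeffAt-⊞ A (0L ∷ scale b A) (suc (suc j))) (coeffAt-scale l (charPoly j) j) ⟩
    coeffAt A (suc (suc j)) ⊕ coeffAt (scale b A) (suc j) ⊕ l ⊗ leadingCoeff j
      ≈⟨ ⊕-congʳ (l ⊗ leadingCoeff j) (⊕-cong (≋-reflexive (coeffAt-beyond A (suc (suc j)) (charPoly-length (suc j))))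
                          (coeffAt-scale b A (suc j))) ⟩
    0L ⊕ b ⊗ leadingCoeff (suc j) ⊕ l ⊗ leadingCoeff j ∎
    where
    A : List (Laurent m)
    A = charPoly (suc j)
    b l : Laurent m
    b = -ᴸ bw (suc j)
    l = -ᴸ λw (suc j)

  prodV : ℕ → Laurent m
  prodV zero    = 1L
  prodV (suc j) = prodV j ⊗ V j

  -- Scaled by V₀ ⋯ V_{j−1}, the leading coefficients satisfy ι_{j+2} = ι_{j+1} − ι_j,
  -- a recurrence of period 6 with ι₀ = ι₁ = 1.
  ι : ℕ → Laurent m
  ι j = leadingCoeff j ⊗ prodV j

  ι-suc-suc : ∀ j → ι (suc (suc j)) ≋ ι (suc j) ⊕ -ᴸ ι j
  ι-suc-suc j = begin
    leadingCoeff (suc (suc j)) ⊗ (P ⊗ V j ⊗ V (suc j))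
      ≈⟨ ⊗-congʳ (P ⊗ V j ⊗ V (suc j)) (leadingCoeff-suc-suc j) ⟩
    (-ᴸ bw (suc j) ⊗ κ₁ ⊕ -ᴸ λw (suc j) ⊗ κ₀) ⊗ (P ⊗ V j ⊗ V (suc j))
      ≈⟨ solve 7 (λ κ₁ κ₀ p v₀ v₁ w₀ w₁ →
                    ((:- (con (ℤ.- + 1) :* w₁)) :* κ₁ :+ (:- (w₁ :* w₀)) :* κ₀) :* (p :* v₀ :* v₁)
                 := κ₁ :* (p :* v₀) :* (v₁ :* w₁) :- κ₀ :* p :* ((v₀ :* w₀) :* (v₁ :* w₁)))
               ≋-refl κ₁ κ₀ P (V j) (V (suc j)) (Vinv j) (Vinv (suc j)) ⟩
    ι (suc j) ⊗ (V (suc j) ⊗ Vinv (suc j)) ⊕ -ᴸ (ι j ⊗ ((V j ⊗ Vinv j) ⊗ (V (suc j) ⊗ Vinv (suc j))))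
      ≈⟨ ⊕-cong (⊗-congˡ (ι (suc j)) (V⊗Vinv (suc j)))
                (-ᴸ‿cong (⊗-congˡ (ι j) (⊗-cong (V⊗Vinv j) (V⊗Vinv (suc j))))) ⟩
    ι (suc j) ⊗ 1L ⊕ -ᴸ (ι j ⊗ (1L ⊗ 1L))
      ≈⟨ solve 2 (λ a b → a :* con (+ 1) :- b :* (con (+ 1) :* con (+ 1)) := a :- b) ≋-refl (ι (suc j)) (ι j) ⟩
    ι (suc j) ⊕ -ᴸ ι j ∎
    where
    P κ₁ κ₀ : Laurent m
    P  = prodV j
    κ₁ = leadingCoeff (suc j)
    κ₀ = leadingCoeff j

  alternating : ℕ → Laurent m
  alternating zero    = 1L
  alternating (suc q) = -ᴸ alternating q

  alternating≉0 : ∀ q → ¬ (alternating q ≋ 0L)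
  alternating≉0 zero    = 1L≉0L
  alternating≉0 (suc q) a≋0 = alternating≉0 q (begin
    alternating q           ≈⟨ solve 1 (λ a → a := :- (:- a)) ≋-refl (alternating q) ⟩
    -ᴸ (-ᴸ alternating q)   ≈⟨ -ᴸ‿cong a≋0 ⟩
    -ᴸ 0L                   ≡⟨⟩
    0L                      ∎)

  ι-period : ∀ q → ι (3 * q) ≋ alternating q × ι (suc (3 * q)) ≋ alternating q
  ι-period zero    = ⊗-identityˡ 1L , (begin
    leadingCoeff 1 ⊗ prodV 1
      ≈⟨ ⊗-congʳ (prodV 1) leadingCoeff-1 ⟩
    (-ᴸ bw 0 ⊗ 1L) ⊗ (1L ⊗ V 0)
      ≈⟨ solve 2 (λ v w → (:- (con (ℤ.- + 1) :* w) :* con (+ 1)) :* (con (+ 1) :* v) := v :* w)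
                 ≋-refl (V 0) (Vinv 0) ⟩
    V 0 ⊗ Vinv 0
      ≈⟨ V⊗Vinv 0 ⟩
    1L ∎)
  ι-period (suc q) = ≡.subst P (≡.sym (*-suc 3 q)) (next {3 * q} (ι-period q))
    where
    P : ℕ → Set
    P a = ι a ≋ alternating (suc q) × ι (suc a) ≋ alternating (suc q)
    next : ∀ {a} → ι a ≋ alternating q × ι (suc a) ≋ alternating q → P (suc (suc (suc a)))
    next {a} (ιa , ιa+1) = ι3 , ≋-trans (ι-suc-suc (suc (suc a)))
                                 (≋-trans (⊕-cong ι3 (-ᴸ‿cong ι2)) (⊕-identityʳ (alternating (suc q))))
      where
      ι2 : ι (suc (suc a)) ≋ 0L
      ι2 = ≋-trans (ι-suc-suc a) (≋-trans (⊕-cong ιa+1 (-ᴸ‿cong ιa)) (-ᴸ‿inverseʳ (alternating q)))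
      ι3 : ι (suc (suc (suc a))) ≋ alternating (suc q)
      ι3 = ≋-trans (ι-suc-suc (suc a)) (⊕-cong ι2 (-ᴸ‿cong ιa+1))

  leadingCoeff≉0 : ∀ q → ¬ (leadingCoeff (suc (3 * q)) ≋ 0L)
  leadingCoeff≉0 q κ≋0 = alternating≉0 q (begin
    alternating q                                    ≈⟨ proj₂ (ι-period q) ⟨
    leadingCoeff (suc (3 * q)) ⊗ prodV (suc (3 * q)) ≈⟨ ⊗-congʳ (prodV (suc (3 * q))) κ≋0 ⟩
    0L ⊗ prodV (suc (3 * q))                         ≡⟨⟩
    0L                                               ∎)

module MotzkinTransfer (m K : ℕ) where

  open import Data.Nat using (pred)
  open import Data.Fin.Properties using (toℕ-fromℕ)
  open import Data.Nat.Properties using (≤-refl; <⇒≤; pred[n]≤n)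
  open LaurentRing m
  open CommutativeRing laurentRing using (setoid; +-cong; +-congˡ; +-assoc; zeroˡ; zeroʳ)
  open ListSum laurentRing
  open import Relation.Binary.Reasoning.Setoid setoid

  transfer : (ℕ → Laurent m) → ℕ → Laurent m
  transfer G h = (if h <ᵇ K then G (suc h) else 0L) ⊕ bw h ⊗ G h ⊕ λw h ⊗ G (pred h)

  transfer-cong : ∀ {F G : ℕ → Laurent m} → (∀ h → F h ≋ G h) → ∀ h → transfer F h ≋ transfer G h
  transfer-cong {F} {G} F≋G h = +-cong (+-cong upper (⊗-congˡ (bw h) (F≋G h))) (⊗-congˡ (λw h) (F≋G (pred h)))
    where
    upper : (if h <ᵇ K then F (suc h) else 0L) ≋ (if h <ᵇ K then G (suc h) else 0L)
    upper with h <ᵇ K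
    ... | true  = F≋G (suc h)
    ... | false = ≋-refl

  unitAt0 : ℕ → Laurent m
  unitAt0 zero    = 1L
  unitAt0 (suc _) = 0L

  -- pathWeights N h: total weight of the paths of length N from height h to 0 within [0, K].
  pathWeights : ℕ → ℕ → Laurent m
  pathWeights zero    = unitAt0
  pathWeights (suc N) = transfer (pathWeights N)

  stepsWeight : ℕ → List Step → Laurent m
  stepsWeight h s = if validFrom K h s then weightFrom h s else 0L

  stepsWeight-U : ∀ h s → stepsWeight h (U ∷ s) ≋ (if h <ᵇ K then stepsWeight (suc h) s else 0L)
  stepsWeight-U h s with h <ᵇ K
  ... | true  = ≋-refl
  ... | false = ≋-refl

  stepsWeight-H : ∀ h s → stepsWeight h (H ∷ s) ≋ bw h ⊗ stepsWeight h s
  stepsWeight-H h s with validFrom K h s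
  ... | true  = ≋-refl
  ... | false = ≋-sym (zeroʳ (bw h))

  stepsWeight-D : ∀ h s → stepsWeight h (D ∷ s) ≋ λw h ⊗ stepsWeight (pred h) s
  stepsWeight-D zero    s = ≋-sym (zeroˡ (stepsWeight 0 s))
  stepsWeight-D (suc h) s with validFrom K h s
  ... | true  = ≋-refl
  ... | false = ≋-sym (zeroʳ (λw (suc h)))

  ∑-stepsWeight-suc : ∀ n h →
    ∑ (allSteps (suc n)) (stepsWeight h) ≋ transfer (λ h′ → ∑ (allSteps n) (stepsWeight h′)) h
  ∑-stepsWeight-suc n h = begin
    ∑ (concatMap extend (allSteps n)) (stepsWeight h)
      ≈⟨ ∑-concatMap extend (allSteps n) (stepsWeight h) ⟩
    ∑ (allSteps n) (λ s → stepsWeight h (U ∷ s) ⊕ (stepsWeight h (H ∷ s) ⊕ (stepsWeight h (D ∷ s) ⊕ 0L)))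
      ≈⟨ ∑-cong (allSteps n) (λ s → +-cong (stepsWeight-U h s) (+-cong (stepsWeight-H h s)
           (≋-trans (⊕-identityʳ _) (stepsWeight-D h s)))) ⟩
    ∑ (allSteps n) (λ s → up s ⊕ (bw h ⊗ stepsWeight h s ⊕ λw h ⊗ stepsWeight (pred h) s))
      ≈⟨ ≋-trans (∑-distrib-+ (allSteps n) _ _) (+-congˡ (∑-distrib-+ (allSteps n) _ _)) ⟩
    ∑ (allSteps n) up ⊕ (∑ (allSteps n) (λ s → bw h ⊗ stepsWeight h s)
                        ⊕ ∑ (allSteps n) (λ s → λw h ⊗ stepsWeight (pred h) s))
      ≈⟨ +-cong (∑-if (h <ᵇ K) (allSteps n) (stepsWeight (suc h)))
           (+-cong (≋-sym (*-distribˡ-∑ (bw h) (allSteps n) _)) (≋-sym (*-distribˡ-∑ (λw h) (allSteps n) _))) ⟩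
    (if h <ᵇ K then Wₙ (suc h) else 0L) ⊕ (bw h ⊗ Wₙ h ⊕ λw h ⊗ Wₙ (pred h))
      ≈⟨ ≋-sym (+-assoc (if h <ᵇ K then Wₙ (suc h) else 0L) (bw h ⊗ Wₙ h) (λw h ⊗ Wₙ (pred h))) ⟩
    transfer Wₙ h ∎
    where
    extend : List Step → List (List Step)
    extend s = (U ∷ s) ∷ (H ∷ s) ∷ (D ∷ s) ∷ []
    up : List Step → Laurent m
    up s = if h <ᵇ K then stepsWeight (suc h) s else 0L
    Wₙ : ℕ → Laurent m
    Wₙ h′ = ∑ (allSteps n) (stepsWeight h′)

  ∑-stepsWeight≋pathWeights : ∀ n h → ∑ (allSteps n) (stepsWeight h) ≋ pathWeights n h
  ∑-stepsWeight≋pathWeights zero    zero    = ⊕-identityʳ 1L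
  ∑-stepsWeight≋pathWeights zero    (suc h) = ≋-refl
  ∑-stepsWeight≋pathWeights (suc n) h =
    ≋-trans (∑-stepsWeight-suc n h) (transfer-cong (∑-stepsWeight≋pathWeights n) h)

  μ≤≋pathWeights : ∀ N → μ≤ {m} K N ≋ pathWeights N 0
  μ≤≋pathWeights N = ≋-trans (∑-filterᵇ (validFrom K 0) (allSteps N) (weightFrom 0)) (∑-stepsWeight≋pathWeights N 0)

  open CharacteristicPolynomial m
  open CoefficientLists laurentRing

  recurrenceCoeffs : List (Laurent m)
  recurrenceCoeffs = map -ᴸ_ (List.drop 1 (charPoly (suc K)))

  recurrenceCoeffs-length : List.length recurrenceCoeffs ≤ suc K
  recurrenceCoeffs-length = ≡.subst (_≤ suc K) (≡.sym (length-map -ᴸ_ (List.drop 1 (charPoly (suc K)))))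
                              (drop1-length (charPoly (suc K)) (charPoly-length (suc K)))
    where
    drop1-length : ∀ (p : List (Laurent m)) {n} → List.length p ≤ suc n → List.length (List.drop 1 p) ≤ n
    drop1-length []      _         = z≤n
    drop1-length (a ∷ p) (s≤s p≤n) = p≤n

  recurrenceCoeff : Fin (suc K) → Laurent m
  recurrenceCoeff i = coeffAt recurrenceCoeffs (toℕ i)

  recurrenceCoeff-last : recurrenceCoeff (Fin.fromℕ K) ≋ -ᴸ leadingCoeff (suc K)
  recurrenceCoeff-last = ≋-trans (≋-reflexive (≡.cong (coeffAt recurrenceCoeffs) (toℕ-fromℕ K)))
        (≋-trans (coeffAt-map- (List.drop 1 (charPoly (suc K))) K)
          (-ᴸ‿cong (≋-reflexive (coeffAt-drop1 (charPoly (suc K)) K))))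

  -- A two-sided orbit of the transfer matrix satisfies the recurrence of its characteristic
  -- polynomial: row j of the orbit equation expresses component j + 1 through components j, j − 1.
  module TwoSided (G : ℤ → ℕ → Laurent m) (G-step : ∀ z h → h ≤ K → transfer (G z) h ≋ G (ℤ.suc z) h) where

    open Solver using (solve; _:=_; _:+_; _:-_)
    open IntegerShifts
    open import Algebra.Properties.Ring (CommutativeRing.ring laurentRing) using (-‿distribˡ-*; +-inverseˡ-unique)

    past : ℤ → ℕ → Laurent m
    past t i = G (t ℤ.- + i) 0

    past-suc : ∀ t i → past t (suc i) ≡ past (t ℤ.- + 1) i
    past-suc t i = ≡.cong (λ z → G z 0) (minus-suc t i)

    row : ∀ z j → j ≤ K →
          (if j <ᵇ K then G z (suc j) else 0L) ≋ G (ℤ.suc z) j ⊕ -ᴸ (bw j ⊗ G z j) ⊕ -ᴸ (λw j ⊗ G z (pred j))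
    row z j j≤K = begin
      X                            ≈⟨ solve 3 (λ x y w → x := x :+ y :+ w :- y :- w) ≋-refl X Y W ⟩
      X ⊕ Y ⊕ W ⊕ -ᴸ Y ⊕ -ᴸ W      ≈⟨ ⊕-congʳ (-ᴸ W) (⊕-congʳ (-ᴸ Y) (G-step z j j≤K)) ⟩
      G (ℤ.suc z) j ⊕ -ᴸ Y ⊕ -ᴸ W  ∎
      where
      X Y W : Laurent m
      X = if j <ᵇ K then G z (suc j) else 0L
      Y = bw j ⊗ G z j
      W = λw j ⊗ G z (pred j)

    Component : ℕ → Set
    Component j = ∀ t → G (t ℤ.- + j) j ≋ weightedSum (charPoly j) (past t)

    row≋charPoly : ∀ j t → Component j → Component (pred j) →
      G (ℤ.suc (t ℤ.- + suc j)) j ⊕ -ᴸ (bw j ⊗ G (t ℤ.- + suc j) j) ⊕ -ᴸ (λw j ⊗ G (t ℤ.- + suc j) (pred j))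
        ≋ weightedSum (charPoly (suc j)) (past t)
    row≋charPoly j t Cj Cj-1 =
      ≋-trans (⊕-cong (⊕-cong current previous) (beforePrevious j Cj-1)) (≋-sym (weightedSum-charPoly-suc j (past t)))
      where
      shifted : ∀ i → past (t ℤ.- + 1) i ≋ past t (suc i)
      shifted i = ≋-reflexive (≡.sym (past-suc t i))
      current : G (ℤ.suc (t ℤ.- + suc j)) j ≋ weightedSum (charPoly j) (past t)
      current = ≋-trans (≋-reflexive (≡.cong (λ z → G z j) (suc-minus-suc t j))) (Cj t)
      previous : -ᴸ (bw j ⊗ G (t ℤ.- + suc j) j) ≋ (-ᴸ bw j) ⊗ weightedSum (charPoly j) (past t ∘ suc)
      previous = ≋-trans (-‿distribˡ-* (bw j) _) (⊗-congˡ (-ᴸ bw j)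
        (≋-trans (≋-reflexive (≡.cong (λ z → G z j) (minus-suc t j)))
          (≋-trans (Cj (t ℤ.- + 1)) (weightedSum-cong (charPoly j) shifted))))
      beforePrevious : ∀ j → Component (pred j) →
        -ᴸ (λw j ⊗ G (t ℤ.- + suc j) (pred j)) ≋ (-ᴸ λw j) ⊗ weightedSum (charPoly (pred j)) (past t ∘ suc ∘ suc)
      beforePrevious zero     _  = ≋-refl
      beforePrevious (suc j′) Cj′ = ≋-trans (-‿distribˡ-* (λw (suc j′)) _) (⊗-congˡ (-ᴸ λw (suc j′))
        (≋-trans (≋-reflexive (≡.cong (λ z → G z j′) (≡.trans (minus-suc t (suc j′)) (minus-suc (t ℤ.- + 1) j′))))
          (≋-trans (Cj′ ((t ℤ.- + 1) ℤ.- + 1))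
            (weightedSum-cong (charPoly j′) (λ i →
              ≋-trans (≋-reflexive (≡.sym (past-suc (t ℤ.- + 1) i))) (shifted (suc i)))))))

    component-0 : Component 0
    component-0 t = ≋-sym (≋-trans (⊕-identityʳ _) (⊗-identityˡ (past t 0)))

    component-suc : ∀ j → j < K → Component j → Component (pred j) → Component (suc j)
    component-suc j j<K Cj Cj-1 t =
      ≋-trans (≋-reflexive below) (≋-trans (row z j (<⇒≤ j<K)) (row≋charPoly j t Cj Cj-1))
      where
      z : ℤ
      z = t ℤ.- + suc j
      below : G z (suc j) ≡ (if j <ᵇ K then G z (suc j) else 0L)
      below rewrite <ᵇ-true j<K = ≡.refl

    component : ∀ j → j ≤ K → Component j
    component zero          _     = component-0
    component (suc zero)    1≤K   = component-suc 0 1≤K component-0 component-0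
    component (suc (suc j)) j+2≤K =
      component-suc (suc j) j+2≤K (component (suc j) (<⇒≤ j+2≤K)) (component j (<⇒≤ (<⇒≤ j+2≤K)))

    charPoly-annihilates : ∀ t → weightedSum (charPoly (suc K)) (past t) ≋ 0L
    charPoly-annihilates t = ≋-sym (≋-trans (≋-reflexive top) (≋-trans (row z K ≤-refl)
                               (row≋charPoly K t (component K ≤-refl) (component (pred K) pred[n]≤n))))
      where
      z : ℤ
      z = t ℤ.- + suc K
      top : 0L ≡ (if K <ᵇ K then G z (suc K) else 0L)
      top rewrite <ᵇ-false (≤-refl {K}) = ≡.refl

    recurrence : SatisfiesRecOnℤ (suc K) recurrenceCoeff (λ z → G z 0)
    recurrence N = ≋⇒≈ (begin
      G N 0
        ≡⟨ ≡.cong (λ z → G z 0) (≡.sym (ℤP.+-identityʳ N)) ⟩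
      past N 0
        ≈⟨ +-inverseˡ-unique _ _ annihilated ⟩
      -ᴸ weightedSum (List.drop 1 Dₖ) (past N ∘ suc)
        ≈⟨ weightedSum-map- (List.drop 1 Dₖ) (past N ∘ suc) ⟨
      weightedSum recurrenceCoeffs (past N ∘ suc)
        ≈⟨ weightedSum≈∑< recurrenceCoeffs (suc K) (past N ∘ suc) recurrenceCoeffs-length ⟩
      ∑< (suc K) (λ i → coeffAt recurrenceCoeffs i ⊗ past N (suc i))
        ≡⟨ ∑-allFin (suc K) (λ i → coeffAt recurrenceCoeffs i ⊗ past N (suc i)) ⟨
      sumL (map (λ i → recurrenceCoeff i ⊗ G (N ℤ.- + suc (toℕ i)) 0) (allFin (suc K))) ∎)
      where
      Dₖ : List (Laurent m)
      Dₖ = charPoly (suc K)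
      annihilated : past N 0 ⊕ weightedSum (List.drop 1 Dₖ) (past N ∘ suc) ≋ 0L
      annihilated = ≋-trans (⊕-congʳ (weightedSum (List.drop 1 Dₖ) (past N ∘ suc))
                              (≋-sym (≋-trans (⊗-congʳ (past N 0) (charPoly-head (suc K))) (⊗-identityˡ (past N 0)))))
                            (≋-trans (≋-sym (weightedSum-head Dₖ (past N))) (charPoly-annihilates N))

module PeakValleySolution (m k : ℕ) where

  open import Data.Nat using (_*_; pred)
  open import Data.Integer using (-[1+_])
  open import Data.Nat.Properties using (≤-pred)
  open import Data.Bool using (true; false)
  open PeakValleyInverse
  open LaurentRing m
  open CommutativeRing laurentRing using (setoid; zeroˡ; zeroʳ)
  open ListSum laurentRing
  open Solver using (solve; _:=_; _:+_; _:*_; :-_; _:-_; con)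
  open import Relation.Binary.Reasoning.Setoid setoid

  private
    K : ℕ
    K = 3 * k

  open MotzkinTransfer m K
    using (transfer; unitAt0; pathWeights; μ≤≋pathWeights; module TwoSided; recurrenceCoeff; recurrenceCoeff-last)
  open CharacteristicPolynomial m using (leadingCoeff; leadingCoeff≉0)

  combination : (ℕ → Laurent m) → (ℕ → ℤ) → Laurent m
  combination v f = ∑< (suc K) (λ l → constL (f l) ⊗ v l)

  combination-scale : ∀ v σ f → constL σ ⊗ combination v f ≋ combination v (λ l → σ ℤ.* f l)
  combination-scale v σ f = ≋-trans (*-distribˡ-∑< (suc K) (constL σ) (λ l → constL (f l) ⊗ v l))
                                    (∑<-cong (suc K) λ l _ →
    ≋-trans (≋-sym (⊗-assoc (constL σ) (constL (f l)) (v l))) (⊗-congʳ (v l) (≋-sym (constL-* σ (f l)))))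

  combination-+ : ∀ v f g → combination v (λ l → f l ℤ.+ g l) ≋ combination v f ⊕ combination v g
  combination-+ v f g = ≋-trans (∑<-cong (suc K) (λ l _ → ≋-trans (⊗-congʳ (v l) (constL-+ (f l) (g l)))
                                                              (⊗-distribʳ (v l) (constL (f l)) (constL (g l)))))
                                (∑<-distrib-+ (suc K) (λ l → constL (f l) ⊗ v l) (λ l → constL (g l) ⊗ v l))

  combination-zero : ∀ v → combination v (λ _ → + 0) ≋ 0L
  combination-zero v = ∑<-zero (suc K) (λ l → ≋-trans (⊗-congʳ (v l) constL-0) (zeroˡ (v l)))

  combination-diagonal : ∀ v σ h → h ≤ K → combination v (λ l → if l ≡ᵇ h then σ else + 0) ≋ constL σ ⊗ v h
  combination-diagonal v σ h h≤K =
    ≋-trans (∑<-cong (suc K) (λ l _ → term l)) (∑<-indicator (suc K) h (λ l → constL σ ⊗ v l) (s≤s h≤K))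
    where
    term : ∀ l → constL (if l ≡ᵇ h then σ else + 0) ⊗ v l ≋ (if l ≡ᵇ h then constL σ ⊗ v l else 0L)
    term l with l ≡ᵇ h
    ... | true  = ≋-refl
    ... | false = ≋-trans (⊗-congʳ (v l) constL-0) (zeroˡ (v l))

  combination-cong : ∀ v {f g} → (∀ l → l ≤ K → f l ≡ g l) → combination v f ≋ combination v g
  combination-cong v f≡g =
    ∑<-cong (suc K) (λ l l<K+1 → ⊗-congʳ (v l) (≋-reflexive (≡.cong constL (f≡g l (≤-pred l<K+1)))))

  combination-negScale : ∀ v σ f → -ᴸ constL σ ⊗ combination v f ≋ combination v (λ l → ℤ.- σ ℤ.* f l)
  combination-negScale v σ f =
    ≋-trans (⊗-congʳ (combination v f) (≋-sym (constL-neg σ))) (combination-scale v (ℤ.- σ) f)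

  adjacency : ℕ → ℕ → ℤ
  adjacency x l = toℤ (x ⇀ l)

  backward : ℕ → ℕ → Laurent m
  backward zero    = unitAt0
  backward (suc n) x = -ᴸ V x ⊗ combination (backward n) (adjacency x)

  invPrefix : ℕ → Laurent m
  invPrefix zero    = 1L
  invPrefix (suc h) = invPrefix h ⊗ Vinv (suc h)

  scaled : ℕ → ℕ → Laurent m
  scaled n h = (constL (sign h) ⊗ invPrefix h) ⊗ backward n h

  module _ (n : ℕ) where

    private
      comb : (ℕ → ℤ) → Laurent m
      comb = combination (backward n)

      withUnit : ∀ X i → X ⊗ (V i ⊗ Vinv i) ≋ X
      withUnit X i = ≋-trans (⊗-congˡ X (V⊗Vinv i)) (⊗-identityʳ X)

    upper-term : ∀ h → (if h <ᵇ K then scaled (suc n) (suc h) else 0L)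
                       ≋ invPrefix h ⊗ comb (λ l → if h <ᵇ K then ℤ.- sign (suc h) ℤ.* adjacency (suc h) l else + 0)
    upper-term h with h <ᵇ K
    ... | false = ≋-sym (≋-trans (⊗-congˡ (invPrefix h) (combination-zero (backward n))) (zeroʳ (invPrefix h)))
    ... | true  = begin
      (s ⊗ (Q ⊗ Vinv (suc h))) ⊗ (-ᴸ V (suc h) ⊗ S)
        ≈⟨ solve 5 (λ s q w v x → (s :* (q :* w)) :* (:- v :* x) := (q :* (:- s :* x)) :* (v :* w))
                   ≋-refl s Q (Vinv (suc h)) (V (suc h)) S ⟩
      (Q ⊗ (-ᴸ s ⊗ S)) ⊗ (V (suc h) ⊗ Vinv (suc h))
        ≈⟨ withUnit (Q ⊗ (-ᴸ s ⊗ S)) (suc h) ⟩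
      Q ⊗ (-ᴸ s ⊗ S)
        ≈⟨ ⊗-congˡ Q (combination-negScale (backward n) (sign (suc h)) (adjacency (suc h))) ⟩
      Q ⊗ comb (λ l → ℤ.- sign (suc h) ℤ.* adjacency (suc h) l) ∎
      where
      s Q S : Laurent m
      s = constL (sign (suc h))
      Q = invPrefix h
      S = comb (adjacency (suc h))

    middle-term : ∀ h → bw h ⊗ scaled (suc n) h ≋ invPrefix h ⊗ comb (λ l → sign h ℤ.* adjacency h l)
    middle-term h = begin
      (constL (ℤ.- + 1) ⊗ Vinv h) ⊗ ((s ⊗ Q) ⊗ (-ᴸ V h ⊗ S))
        ≈⟨ solve 5 (λ w s q v x → (con (ℤ.- + 1) :* w) :* ((s :* q) :* (:- v :* x)) := (q :* (s :* x)) :* (v :* w))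
                   ≋-refl (Vinv h) s Q (V h) S ⟩
      (Q ⊗ (s ⊗ S)) ⊗ (V h ⊗ Vinv h)
        ≈⟨ withUnit (Q ⊗ (s ⊗ S)) h ⟩
      Q ⊗ (s ⊗ S)
        ≈⟨ ⊗-congˡ Q (combination-scale (backward n) (sign h) (adjacency h)) ⟩
      Q ⊗ comb (λ l → sign h ℤ.* adjacency h l) ∎
      where
      s Q S : Laurent m
      s = constL (sign h)
      Q = invPrefix h
      S = comb (adjacency h)

    lower-term : ∀ h → λw h ⊗ scaled (suc n) (pred h) ≋ invPrefix h ⊗ comb (belowTerm h)
    lower-term zero     = ≋-sym (≋-trans (⊗-congˡ 1L (combination-zero (backward n))) (zeroʳ 1L))
    lower-term (suc h′) = begin
      (Vinv (suc h′) ⊗ Vinv h′) ⊗ ((s ⊗ Q′) ⊗ (-ᴸ V h′ ⊗ S))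
        ≈⟨ solve 6 (λ w w′ s q v x → (w :* w′) :* ((s :* q) :* (:- v :* x)) := ((q :* w) :* (:- s :* x)) :* (v :* w′))
                   ≋-refl (Vinv (suc h′)) (Vinv h′) s Q′ (V h′) S ⟩
      (invPrefix (suc h′) ⊗ (-ᴸ s ⊗ S)) ⊗ (V h′ ⊗ Vinv h′)
        ≈⟨ withUnit (invPrefix (suc h′) ⊗ (-ᴸ s ⊗ S)) h′ ⟩
      invPrefix (suc h′) ⊗ (-ᴸ s ⊗ S)
        ≈⟨ ⊗-congˡ (invPrefix (suc h′)) (combination-negScale (backward n) (sign h′) (adjacency h′)) ⟩
      invPrefix (suc h′) ⊗ comb (belowTerm (suc h′)) ∎
      where
      s Q′ S : Laurent m
      s  = constL (sign h′)
      Q′ = invPrefix h′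
      S  = comb (adjacency h′)

    transfer-scaled : ∀ h → h ≤ K → transfer (scaled (suc n)) h ≋ scaled n h
    transfer-scaled h h≤K = begin
      transfer (scaled (suc n)) h
        ≈⟨ ⊕-cong (⊕-cong (upper-term h) (middle-term h)) (lower-term h) ⟩
      Q ⊗ comb fU ⊕ Q ⊗ comb fM ⊕ Q ⊗ comb fL
        ≈⟨ solve 4 (λ q u v w → q :* u :+ q :* v :+ q :* w := q :* (u :+ v :+ w))
                   ≋-refl Q (comb fU) (comb fM) (comb fL) ⟩
      Q ⊗ (comb fU ⊕ comb fM ⊕ comb fL)
        ≈⟨ ⊗-congˡ Q (≋-sym (≋-trans (combination-+ (backward n) (λ l → fU l ℤ.+ fM l) fL)
                                      (⊕-congʳ (comb fL) (combination-+ (backward n) fU fM)))) ⟩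
      Q ⊗ comb (transferColumn K h)
        ≈⟨ ⊗-congˡ Q (combination-cong (backward n) (λ l → transferColumn≡diagonal k h l h≤K)) ⟩
      Q ⊗ comb (λ l → if l ≡ᵇ h then sign h else + 0)
        ≈⟨ ⊗-congˡ Q (combination-diagonal (backward n) (sign h) h h≤K) ⟩
      Q ⊗ (constL (sign h) ⊗ backward n h)
        ≈⟨ solve 3 (λ q s b → q :* (s :* b) := (s :* q) :* b) ≋-refl Q (constL (sign h)) (backward n h) ⟩
      scaled n h ∎
      where
      Q : Laurent m
      Q = invPrefix h
      fU fM fL : ℕ → ℤ
      fU l = if h <ᵇ K then ℤ.- sign (suc h) ℤ.* adjacency (suc h) l else + 0
      fM l = sign h ℤ.* adjacency h l
      fL   = belowTerm h

  pvTerm : ℕ → List ℕ → Laurent m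
  pvTerm x s = if admissibleFrom x s then wt s else 0L

  pvSum : ℕ → ℕ → Laurent m
  pvSum n x = ∑ (allSeqs K n) (pvTerm x)

  constL-toℤ : ∀ b → constL (toℤ b) ≋ (if b then 1L else 0L)
  constL-toℤ true  = ≋-refl
  constL-toℤ false = constL-0

  pvTerm-cons : ∀ x a s → pvTerm x (a ∷ s) ≋ (constL (adjacency x a) ⊗ V a) ⊗ pvTerm a s
  pvTerm-cons x a s with x ⇀ a
  ... | false = ≋-sym (≋-trans (⊗-congʳ (pvTerm a s) (≋-trans (⊗-congʳ (V a) constL-0) (zeroˡ (V a))))
                              (zeroˡ (pvTerm a s)))
  ... | true with admissibleFrom a s
  ...   | true  = ≋-sym (⊗-congʳ (wt s) (⊗-identityˡ (V a)))
  ...   | false = ≋-sym (zeroʳ (1L ⊗ V a))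

  pvSum-suc : ∀ n x → pvSum (suc n) x ≋ ∑< (suc K) (λ a → (constL (adjacency x a) ⊗ V a) ⊗ pvSum n a)
  pvSum-suc n x = begin
    ∑ (concatMap prepend (allSeqs K n)) (pvTerm x)
      ≈⟨ ∑-concatMap prepend (allSeqs K n) (pvTerm x) ⟩
    ∑ (allSeqs K n) (λ s → ∑ (map (_∷ s) (upTo (suc K))) (pvTerm x))
      ≈⟨ ∑-cong (allSeqs K n) (λ s → ≋-reflexive (∑-map (_∷ s) (upTo (suc K)) (pvTerm x))) ⟩
    ∑ (allSeqs K n) (λ s → ∑ (upTo (suc K)) (λ a → pvTerm x (a ∷ s)))
      ≈⟨ ∑-comm (allSeqs K n) (upTo (suc K)) (λ s a → pvTerm x (a ∷ s)) ⟩
    ∑ (upTo (suc K)) (λ a → ∑ (allSeqs K n) (λ s → pvTerm x (a ∷ s)))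
      ≈⟨ ∑-cong (upTo (suc K)) (λ a → ≋-trans (∑-cong (allSeqs K n) (pvTerm-cons x a))
               (≋-sym (*-distribˡ-∑ (constL (adjacency x a) ⊗ V a) (allSeqs K n) (pvTerm a)))) ⟩
    ∑ (upTo (suc K)) (λ a → (constL (adjacency x a) ⊗ V a) ⊗ pvSum n a)
      ≡⟨ ∑-upTo (suc K) _ ⟩
    ∑< (suc K) (λ a → (constL (adjacency x a) ⊗ V a) ⊗ pvSum n a) ∎
    where
    prepend : List ℕ → List (List ℕ)
    prepend s = map (_∷ s) (upTo (suc K))

  combination-unitAt0 : ∀ f → combination unitAt0 f ≋ constL (f 0)
  combination-unitAt0 f = ≋-trans (⊕-cong (⊗-identityʳ (constL (f 0))) (∑<-zero K (λ l → zeroʳ (constL (f (suc l))))))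
                                  (⊕-identityʳ (constL (f 0)))

  backward-pvSum : ∀ n x → backward (suc n) x ≋ (constL ((ℤ.- + 1) ℤ.^ suc n) ⊗ V x) ⊗ pvSum n x
  backward-pvSum zero x = begin
    -ᴸ V x ⊗ combination unitAt0 (adjacency x)
      ≈⟨ ⊗-congˡ (-ᴸ V x) (combination-unitAt0 (adjacency x)) ⟩
    -ᴸ V x ⊗ constL (adjacency x 0)
      ≈⟨ ⊗-congˡ (-ᴸ V x) (constL-toℤ (x ⇀ 0)) ⟩
    -ᴸ V x ⊗ pvTerm x []
      ≈⟨ solve 2 (λ v p → :- v :* p := (con (ℤ.- + 1) :* v) :* (p :+ con (+ 0))) ≋-refl (V x) (pvTerm x []) ⟩
    (constL (ℤ.- + 1) ⊗ V x) ⊗ (pvTerm x [] ⊕ constL (+ 0))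
      ≈⟨ ⊗-congˡ (constL (ℤ.- + 1) ⊗ V x) (⊕-congˡ (pvTerm x []) constL-0) ⟩
    (constL (ℤ.- + 1) ⊗ V x) ⊗ pvSum 0 x ∎
  backward-pvSum (suc n) x = begin
    -ᴸ V x ⊗ combination (backward (suc n)) (adjacency x)
      ≈⟨ ⊗-congˡ (-ᴸ V x) (∑<-cong (suc K) (λ l _ → ≋-trans (⊗-congˡ (constL (adjacency x l)) (backward-pvSum n l))
           (solve 4 (λ a c v p → a :* ((c :* v) :* p) := c :* ((a :* v) :* p))
                  ≋-refl (constL (adjacency x l)) c (V l) (pvSum n l)))) ⟩
    -ᴸ V x ⊗ ∑< (suc K) (λ l → c ⊗ ((constL (adjacency x l) ⊗ V l) ⊗ pvSum n l))
      ≈⟨ ⊗-congˡ (-ᴸ V x) (≋-sym (*-distribˡ-∑< (suc K) c (λ l → (constL (adjacency x l) ⊗ V l) ⊗ pvSum n l))) ⟩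
    -ᴸ V x ⊗ (c ⊗ ∑< (suc K) (λ l → (constL (adjacency x l) ⊗ V l) ⊗ pvSum n l))
      ≈⟨ ⊗-congˡ (-ᴸ V x) (⊗-congˡ c (≋-sym (pvSum-suc n x))) ⟩
    -ᴸ V x ⊗ (c ⊗ pvSum (suc n) x)
      ≈⟨ solve 3 (λ v c p → :- v :* (c :* p) := ((con (ℤ.- + 1) :* c) :* v) :* p) ≋-refl (V x) c (pvSum (suc n) x) ⟩
    ((constL (ℤ.- + 1) ⊗ c) ⊗ V x) ⊗ pvSum (suc n) x
      ≈⟨ ⊗-congʳ (pvSum (suc n) x) (⊗-congʳ (V x) (≋-sym (constL-* (ℤ.- + 1) ((ℤ.- + 1) ℤ.^ suc n)))) ⟩
    (constL ((ℤ.- + 1) ℤ.^ suc (suc n)) ⊗ V x) ⊗ pvSum (suc n) x ∎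
    where
    c : Laurent m
    c = constL ((ℤ.- + 1) ℤ.^ suc n)

  rhs≋backward : ∀ n → rhs {m} K (suc n) ≋ backward (suc n) 0
  rhs≋backward n = ≋-trans (⊗-congˡ (constL ((ℤ.- + 1) ℤ.^ suc n) ⊗ V 0) (begin
    ∑ (modPV3 K n) wt
      ≈⟨ ∑-filterᵇ isModPV3 (allSeqs K n) wt ⟩
    ∑ (allSeqs K n) (λ s → if isModPV3 s then wt s else 0L)
      ≈⟨ ∑-cong (allSeqs K n) (λ s → ≋-reflexive
           (≡.cong (λ b → if b then wt s else 0L) (isModPV3≡admissibleFrom0 s))) ⟩
    pvSum n 0 ∎))
    (≋-sym (backward-pvSum n 0))

  scaled-0 : ∀ h → scaled 0 h ≋ pathWeights 0 h
  scaled-0 zero    = solve 0 ((con (+ 1) :* con (+ 1)) :* con (+ 1) := con (+ 1)) ≋-refl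
  scaled-0 (suc h) = zeroʳ (constL (sign (suc h)) ⊗ invPrefix (suc h))

  twoSided : ℤ → ℕ → Laurent m
  twoSided (+ N)    = pathWeights N
  twoSided -[1+ n ] = scaled (suc n)

  twoSided-step : ∀ z h → h ≤ K → transfer (twoSided z) h ≋ twoSided (ℤ.suc z) h
  twoSided-step (+ N)          h _   = ≋-refl
  twoSided-step -[1+ zero ]    h h≤K = ≋-trans (transfer-scaled 0 h h≤K) (scaled-0 h)
  twoSided-step -[1+ suc n ]   h h≤K = transfer-scaled (suc n) h h≤K

  sequence : ℤ → Laurent m
  sequence z = twoSided z 0

  sequence-nonnegative : ∀ N → sequence (+ N) ≈ μ≤ K N
  sequence-nonnegative N = ≋⇒≈ (≋-sym (μ≤≋pathWeights N))

  sequence-negative : ∀ n → 1 ≤ n → sequence (ℤ.- (+ n)) ≈ rhs K n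
  sequence-negative (suc n) _ = ≋⇒≈ (≋-sym (≋-trans (rhs≋backward n)
    (solve 1 (λ b → b := (con (+ 1) :* con (+ 1)) :* b) ≋-refl (backward (suc n) 0))))

  sequence-recurrence : SatisfiesRecOnℤ (suc K) recurrenceCoeff sequence
  sequence-recurrence = TwoSided.recurrence twoSided twoSided-step

  recurrenceCoeff-last≉0 : ¬ (recurrenceCoeff (Fin.fromℕ K) ≈ 0L)
  recurrenceCoeff-last≉0 c≈0 = leadingCoeff≉0 k (begin
    leadingCoeff (suc K)              ≈⟨ solve 1 (λ x → x := :- (:- x)) ≋-refl (leadingCoeff (suc K)) ⟩
    -ᴸ (-ᴸ leadingCoeff (suc K))      ≈⟨ -ᴸ‿cong (≋-trans (≋-sym recurrenceCoeff-last) (mk≋ c≈0)) ⟩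
    0L                                ∎)

open import Data.Integer using (-_)
open import Data.Nat using (_*_)
open import Data.Fin using (fromℕ)

theorem4p5 : (k : ℕ) → 1 ≤ k →
    Σ ℕ (λ d → Σ (Fin (suc d) → Laurent (suc (3 * k))) (λ c →
    ¬ (c (fromℕ d) ≈ 0L) ×
    Σ (ℤ → Laurent (suc (3 * k))) (λ g →
    (∀ (N : ℕ) → g (+ N) ≈ μ≤ (3 * k) N) ×
    SatisfiesRecOnℤ (suc d) c g ×
    (∀ (n : ℕ) → 1 ≤ n → g (- (+ n)) ≈ rhs (3 * k) n))))
theorem4p5 k _ =
  3 * k , recurrenceCoeff , recurrenceCoeff-last≉0 ,
  sequence , sequence-nonnegative , sequence-recurrence , sequence-negative
  where
  open MotzkinTransfer (suc (3 * k)) (3 * k) using (recurrenceCoeff)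
  open PeakValleySolution (suc (3 * k)) k
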